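{- Let $t$ be any binary tree pattern with $k\ge 2$ leaves. Then for every $n\ge 1$, $$\mathrm{av}_t(n) = s_{\{231,\,(k-1)(k-2)\cdots 21\}}(n-1).$$
   Context: All trees are full binary trees: rooted, ordered (plane) trees in which every vertex has either $0$ children (a leaf) or exactly $2$ ordered children (left and right). A tree $T$ contains a pattern $t$ (non-contiguously) if there is a tree $T^*$ obtained from $T$ by a finite sequence of edge contractions such that $t$ is a contiguous, rooted, ordered subtree of $T^*$; concretely, there is an injective map $\varphi$ from the vertices of $t$ to those of $T$ such that for every internal vertex $u$ of $t$ with left child $u_1$ and right child $u_2$, $\varphi(u_1)$ lies in the subtree rooted at the left child of $\varphi(u)$ and $\varphi(u_2)$ lies in the subtree rooted at the right child of $\varphi(u)$. Otherwise $T$ avoids $t$. $\mathrm{av}_t(n)$ is the number of binary trees with $n$ leaves avoiding $t$. For permutations $\pi=\pi_1\cdots\pi_n\in S(n)$ and $\rho\in S(m)$, $\pi$ contains $\rho$ if there are indices $i_1<\cdots<i_m$ with $\pi_{i_a}<\pi_{i_b}$ iff $\rho_a<\rho_b$; otherwise $\pi$ avoids $\rho$. For a set $Q$ of permutations, $s_Q(n)$ is the number of permutations in $S(n)$ avoiding every pattern in $Q$ ($S(0)$ consists of the empty permutation). Here $(k-1)(k-2)\cdots 21$ denotes the decreasing permutation of length $k-1$. -}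

module Defs where

open import Data.Nat using (ℕ; zero; suc; _+_; _<_)
open import Data.Fin using (Fin; cast)
open import Data.List using (List; []; _∷_; length; lookup; map; upTo)
open import Data.List.Membership.Propositional using (_∈_)
open import Data.List.Relation.Unary.Unique.Propositional using (Unique)
open import Data.List.Relation.Binary.Sublist.Propositional using (_⊆_)
open import Data.List.Relation.Binary.Permutation.Propositional using (_↭_)
open import Data.Product using (Σ; ∃; _×_)
open import Data.Sum using (_⊎_)
open import Relation.Nullary using (¬_)
open import Relation.Binary.PropositionalEquality using (_≡_)
open import Function.Bundles using (_⇔_)

HasCard : {A : Set} → (A → Set) → ℕ → Set
HasCard {A} P m = Σ (List A) λ xs → Unique xs × (∀ x → (x ∈ xs) ⇔ P x) × (length xs ≡ m)

data Tree : Set where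
  leaf : Tree
  node : Tree → Tree → Tree

leaves : Tree → ℕ
leaves leaf       = 1
leaves (node l r) = leaves l + leaves r

-- EmbAt t T : t embeds into T with the root of t sent to the root of T.
-- Contains T t : t embeds into T with the root of t sent to some vertex of T.
-- (For an internal vertex u of t, the image of its left (right) child must
-- lie in the subtree rooted at the left (right) child of the image of u;
-- injectivity is automatic since these subtrees are disjoint.)
mutual
  data EmbAt : Tree → Tree → Set where
    leafAt : ∀ {T} → EmbAt leaf T
    nodeAt : ∀ {a b L R} → Contains L a → Contains R b → EmbAt (node a b) (node L R)

  data Contains : Tree → Tree → Set where
    here  : ∀ {T t} → EmbAt t T → Contains T t
    left  : ∀ {L R t} → Contains L t → Contains (node L R) t
    right : ∀ {L R t} → Contains R t → Contains (node L R) t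

Avoids : Tree → Tree → Set
Avoids T t = ¬ Contains T t

AvTree : Tree → ℕ → ℕ → Set
AvTree t n m = HasCard (λ T → (leaves T ≡ n) × Avoids T t) m

IsPerm : ℕ → List ℕ → Set
IsPerm n π = π ↭ map suc (upTo n)

SameOrder : List ℕ → List ℕ → Set
SameOrder ys ρ = Σ (length ys ≡ length ρ) λ e →
  ∀ (a b : Fin (length ys)) →
    (lookup ys a < lookup ys b) ⇔ (lookup ρ (cast e a) < lookup ρ (cast e b))

PContains : List ℕ → List ℕ → Set
PContains π ρ = ∃ λ ys → (ys ⊆ π) × SameOrder ys ρ

AvoidsAll : List ℕ → List (List ℕ) → Set
AvoidsAll π Q = ∀ ρ → ρ ∈ Q → ¬ PContains π ρ

SQ : List (List ℕ) → ℕ → ℕ → Set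
SQ Q n m = HasCard (λ π → IsPerm n π × AvoidsAll π Q) m

decreasing : ℕ → List ℕ
decreasing zero    = []
decreasing (suc j) = suc j ∷ decreasing j

p231 : List ℕ
p231 = 2 ∷ 3 ∷ 1 ∷ []

module Submission where

open import Defs
open import Data.Nat using (ℕ; suc; _≤_; _∸_)
open import Data.List using (List; []; _∷_)
open import Data.Product using (∃; _×_; _,_)

-- Let A_t = Σ_n av_t(n) xⁿ.  Since node L R avoids t = node a b iff L and R
-- avoid t and (L avoids a or R avoids b), inclusion–exclusion gives
--   A_t + A_a A_b = x + A_a A_t + A_t A_b,
-- whose solution is unique given A_a, A_b (1 - A_a - A_b is invertible).
-- The left combs satisfy c_{j+1} = x + c_j c_{j+1}, and c_{p+q+1} solves the
-- equation for (c_p, c_q); so by induction on t, A_t = c_{k-1}.  Finally,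
-- writing a tree's root value first, then the smaller values of its left
-- subtree and the larger values of its right subtree, is a bijection onto
-- 231-avoiding permutations turning the comb with k leaves into (k-1)⋯21.
-- Modules, in order: PowerSeries, SeriesAlgebra (the algebra above),
-- Containment, Enumeration, Counting (the equation), WilfEquivalence
-- (A_t = c_{k-1}), Permutations (the bijection), Cardinalities; then theorem6.

module PowerSeries where

  open import Data.Nat using (ℕ; zero; suc; _<_; s≤s; z≤n)
  open import Data.Nat.Induction using (<-rec)
  open import Data.Integer using (ℤ; 0ℤ; 1ℤ; _+_; _*_; -_)
  import Data.Integer.Properties as ℤ
  open import Algebra.Bundles using (CommutativeRing)
  open import Algebra.Structures using (IsCommutativeRing)
  open import Algebra.Properties.CommutativeSemigroup ℤ.+-commutativeSemigroup
    using (interchange)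
  import Algebra.Construct.Pointwise as Pointwise
  open import Data.Product using (_,_)
  open import Function using (_∘_)
  open import Relation.Binary.PropositionalEquality
  open ≡-Reasoning

  Series : Set
  Series = ℕ → ℤ

  infix  4 _≈_
  infixl 6 _⊕_
  infixl 7 _⊛_

  _≈_ : Series → Series → Set
  f ≈ g = ∀ n → f n ≡ g n

  _⊕_ : Series → Series → Series
  (f ⊕ g) n = f n + g n

  ⊖_ : Series → Series
  (⊖ f) n = - f n

  𝟘 𝟙 : Series
  𝟘 _       = 0ℤ
  𝟙 zero    = 1ℤ
  𝟙 (suc _) = 0ℤ

  -- The constant series c, written so that const 0ℤ is 𝟘 by computation.
  const : ℤ → Series
  const c n = c * 𝟙 n

  -- The Cauchy product, (f ⊛ g) n = Σ_{i+j=n} f i * g j, defined by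
  -- peeling off the term i = 0.
  _⊛_ : Series → Series → Series
  (f ⊛ g) zero    = f 0 * g 0
  (f ⊛ g) (suc n) = f 0 * g (suc n) + ((f ∘ suc) ⊛ g) n

  ⊛-cong : ∀ {f f′ g g′} → f ≈ f′ → g ≈ g′ → f ⊛ g ≈ f′ ⊛ g′
  ⊛-cong f≈ g≈ zero    = cong₂ _*_ (f≈ 0) (g≈ 0)
  ⊛-cong f≈ g≈ (suc n) =
    cong₂ _+_ (cong₂ _*_ (f≈ 0) (g≈ (suc n))) (⊛-cong (f≈ ∘ suc) g≈ n)

  ⊛-distribʳ-⊕ : ∀ f g h → (f ⊕ g) ⊛ h ≈ f ⊛ h ⊕ g ⊛ h
  ⊛-distribʳ-⊕ f g h zero    = ℤ.*-distribʳ-+ (h 0) (f 0) (g 0)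
  ⊛-distribʳ-⊕ f g h (suc n) = begin
    (f 0 + g 0) * h (suc n) + ((f ∘ suc ⊕ g ∘ suc) ⊛ h) n
      ≡⟨ cong₂ _+_ (ℤ.*-distribʳ-+ (h (suc n)) (f 0) (g 0))
                   (⊛-distribʳ-⊕ (f ∘ suc) (g ∘ suc) h n) ⟩
    (f 0 * h (suc n) + g 0 * h (suc n)) + (((f ∘ suc) ⊛ h) n + ((g ∘ suc) ⊛ h) n)
      ≡⟨ interchange (f 0 * h (suc n)) _ _ _ ⟩
    (f ⊛ h ⊕ g ⊛ h) (suc n) ∎

  ⊛-scaleˡ : ∀ c f g → (λ n → c * f n) ⊛ g ≈ λ n → c * (f ⊛ g) n
  ⊛-scaleˡ c f g zero    = ℤ.*-assoc c (f 0) (g 0)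
  ⊛-scaleˡ c f g (suc n) = begin
    c * f 0 * g (suc n) + ((λ m → c * f (suc m)) ⊛ g) n
      ≡⟨ cong₂ _+_ (ℤ.*-assoc c (f 0) (g (suc n))) (⊛-scaleˡ c (f ∘ suc) g n) ⟩
    c * (f 0 * g (suc n)) + c * ((f ∘ suc) ⊛ g) n
      ≡⟨ ℤ.*-distribˡ-+ c _ _ ⟨
    c * (f ⊛ g) (suc n) ∎

  ⊛-unfoldʳ : ∀ f g n → (f ⊛ g) (suc n) ≡ f (suc n) * g 0 + (f ⊛ (g ∘ suc)) n
  ⊛-unfoldʳ f g zero    = ℤ.+-comm (f 0 * g 1) (f 1 * g 0)
  ⊛-unfoldʳ f g (suc n) = begin
    a + ((f ∘ suc) ⊛ g) (suc n)   ≡⟨ cong (a +_) (⊛-unfoldʳ (f ∘ suc) g n) ⟩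
    a + (b + r)                   ≡⟨ ℤ.+-assoc a b r ⟨
    a + b + r                     ≡⟨ cong (_+ r) (ℤ.+-comm a b) ⟩
    b + a + r                     ≡⟨ ℤ.+-assoc b a r ⟩
    b + (f ⊛ (g ∘ suc)) (suc n)   ∎
    where
    a = f 0 * g (suc (suc n))
    b = f (suc (suc n)) * g 0
    r = ((f ∘ suc) ⊛ (g ∘ suc)) n

  ⊛-comm : ∀ f g → f ⊛ g ≈ g ⊛ f
  ⊛-comm f g zero    = ℤ.*-comm (f 0) (g 0)
  ⊛-comm f g (suc n) = begin
    f 0 * g (suc n) + ((f ∘ suc) ⊛ g) n
      ≡⟨ cong₂ _+_ (ℤ.*-comm (f 0) _) (⊛-comm (f ∘ suc) g n) ⟩
    g (suc n) * f 0 + (g ⊛ (f ∘ suc)) n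
      ≡⟨ ⊛-unfoldʳ g f n ⟨
    (g ⊛ f) (suc n) ∎

  ⊛-assoc : ∀ f g h → (f ⊛ g) ⊛ h ≈ f ⊛ (g ⊛ h)
  ⊛-assoc f g h zero    = ℤ.*-assoc (f 0) (g 0) (h 0)
  ⊛-assoc f g h (suc n) = begin
    f 0 * g 0 * h (suc n) + (((f ⊛ g) ∘ suc) ⊛ h) n
      ≡⟨ cong₂ _+_ (ℤ.*-assoc (f 0) (g 0) (h (suc n))) tail-assoc ⟩
    f 0 * (g 0 * h (suc n)) + (f 0 * ((g ∘ suc) ⊛ h) n + ((f ∘ suc) ⊛ (g ⊛ h)) n)
      ≡⟨ ℤ.+-assoc (f 0 * (g 0 * h (suc n))) _ _ ⟨
    f 0 * (g 0 * h (suc n)) + f 0 * ((g ∘ suc) ⊛ h) n + ((f ∘ suc) ⊛ (g ⊛ h)) n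
      ≡⟨ cong (_+ ((f ∘ suc) ⊛ (g ⊛ h)) n) (ℤ.*-distribˡ-+ (f 0) _ _) ⟨
    (f ⊛ (g ⊛ h)) (suc n) ∎
    where
    tail-assoc : (((f ⊛ g) ∘ suc) ⊛ h) n ≡ f 0 * ((g ∘ suc) ⊛ h) n + ((f ∘ suc) ⊛ (g ⊛ h)) n
    tail-assoc = begin
      (((f ⊛ g) ∘ suc) ⊛ h) n
        ≡⟨ ⊛-distribʳ-⊕ (λ m → f 0 * g (suc m)) ((f ∘ suc) ⊛ g) h n ⟩
      ((λ m → f 0 * g (suc m)) ⊛ h) n + (((f ∘ suc) ⊛ g) ⊛ h) n
        ≡⟨ cong₂ _+_ (⊛-scaleˡ (f 0) (g ∘ suc) h n) (⊛-assoc (f ∘ suc) g h n) ⟩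
      f 0 * ((g ∘ suc) ⊛ h) n + ((f ∘ suc) ⊛ (g ⊛ h)) n ∎

  ⊛-zeroˡ : ∀ f → 𝟘 ⊛ f ≈ 𝟘
  ⊛-zeroˡ f zero    = refl
  ⊛-zeroˡ f (suc n) = trans (ℤ.+-identityˡ _) (⊛-zeroˡ f n)

  const-⊛ : ∀ c f → const c ⊛ f ≈ λ n → c * f n
  const-⊛ c f zero    = cong (_* f 0) (ℤ.*-identityʳ c)
  const-⊛ c f (suc n) = begin
    c * 1ℤ * f (suc n) + ((const c ∘ suc) ⊛ f) n
      ≡⟨ cong₂ _+_ (cong (_* f (suc n)) (ℤ.*-identityʳ c))
                   (⊛-cong {g = f} (λ _ → ℤ.*-zeroʳ c) (λ _ → refl) n) ⟩
    c * f (suc n) + (𝟘 ⊛ f) n ≡⟨ cong (c * f (suc n) +_) (⊛-zeroˡ f n) ⟩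
    c * f (suc n) + 0ℤ        ≡⟨ ℤ.+-identityʳ _ ⟩
    c * f (suc n)             ∎

  ⊛-identityˡ : ∀ f → 𝟙 ⊛ f ≈ f
  ⊛-identityˡ f n = trans (⊛-cong {g = f} (λ m → sym (ℤ.*-identityˡ (𝟙 m))) (λ _ → refl) n)
                      (trans (const-⊛ 1ℤ f n) (ℤ.*-identityˡ (f n)))

  ⊛-leading : ∀ n f g → (∀ {i} → i < n → f i ≡ 0ℤ) → (f ⊛ g) n ≡ f n * g 0
  ⊛-leading zero    f g f<n≡0 = refl
  ⊛-leading (suc n) f g f<n≡0 = begin
    f 0 * g (suc n) + ((f ∘ suc) ⊛ g) n ≡⟨ cong (λ z → z * g (suc n) + ((f ∘ suc) ⊛ g) n) (f<n≡0 (s≤s z≤n)) ⟩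
    0ℤ * g (suc n) + ((f ∘ suc) ⊛ g) n  ≡⟨ ℤ.+-identityˡ _ ⟩
    ((f ∘ suc) ⊛ g) n                   ≡⟨ ⊛-leading n (f ∘ suc) g (f<n≡0 ∘ s≤s) ⟩
    f (suc n) * g 0                     ∎

  unit-not-zero-divisor : ∀ u f → u 0 ≡ 1ℤ → u ⊛ f ≈ 𝟘 → f ≈ 𝟘
  unit-not-zero-divisor u f u₀≡1 uf≈𝟘 = <-rec (λ n → f n ≡ 0ℤ) vanishes
    where
    vanishes : ∀ n → (∀ {i} → i < n → f i ≡ 0ℤ) → f n ≡ 0ℤ
    vanishes n f<n≡0 = trans (sym (ℤ.*-identityʳ (f n))) (trans (cong (f n *_) (sym u₀≡1))
      (trans (sym (⊛-leading n f u f<n≡0)) (trans (⊛-comm f u n) (uf≈𝟘 n))))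

  isCommutativeRing : IsCommutativeRing _≈_ _⊕_ _⊛_ ⊖_ 𝟘 𝟙
  isCommutativeRing = record
    { isRing = record
      { +-isAbelianGroup = Pointwise.isAbelianGroup ℕ ℤ.+-0-isAbelianGroup
      ; *-cong           = ⊛-cong
      ; *-assoc          = ⊛-assoc
      ; *-identity       = ⊛-identityˡ , λ f n → trans (⊛-comm f 𝟙 n) (⊛-identityˡ f n)
      ; distrib          = distribˡ , λ h f g → ⊛-distribʳ-⊕ f g h
      }
    ; *-comm = ⊛-comm
    }
    where
    distribˡ : ∀ f g h → f ⊛ (g ⊕ h) ≈ f ⊛ g ⊕ f ⊛ h
    distribˡ f g h n = begin
      (f ⊛ (g ⊕ h)) n         ≡⟨ ⊛-comm f (g ⊕ h) n ⟩
      ((g ⊕ h) ⊛ f) n         ≡⟨ ⊛-distribʳ-⊕ g h f n ⟩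
      (g ⊛ f ⊕ h ⊛ f) n       ≡⟨ cong₂ _+_ (⊛-comm g f n) (⊛-comm h f n) ⟩
      (f ⊛ g ⊕ f ⊛ h) n       ∎

  seriesRing : CommutativeRing _ _
  seriesRing = record { isCommutativeRing = isCommutativeRing }

module SeriesAlgebra where

  open PowerSeries
  open import Data.Nat using (ℕ; zero; suc) renaming (_+_ to _+ℕ_)
  import Data.Nat.Properties as ℕ
  open import Data.Integer using (ℤ; 0ℤ; 1ℤ; _*_)
  import Data.Integer.Properties as ℤ
  open import Data.Maybe using (Maybe; just; nothing)
  open import Relation.Nullary using (yes; no)
  open import Function using (_∘_)
  import Relation.Binary.PropositionalEquality as ≡
  open ≡ using (_≡_)
  open import Algebra.Bundles using (CommutativeRing)
  open import Algebra.Solver.Ring.AlmostCommutativeRing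
    using (fromCommutativeRing; _-Raw-AlmostCommutative⟶_; AlmostCommutativeRing)

  -- const is a ring homomorphism ℤ → Series; through it the ring solver
  -- works in the series ring with integer coefficients.
  const-⊛-const : ∀ a b → const (a * b) ≈ const a ⊛ const b
  const-⊛-const a b n = begin≡
    a * b * 𝟙 n   ≡⟨ ℤ.*-assoc a b (𝟙 n) ⟩
    a * const b n ≡⟨ const-⊛ a (const b) n ⟨
    (const a ⊛ const b) n ∎≡
    where open ≡.≡-Reasoning renaming (begin_ to begin≡_; _∎ to _∎≡)

  const-hom : AlmostCommutativeRing.rawRing (fromCommutativeRing ℤ.+-*-commutativeRing)
                -Raw-AlmostCommutative⟶ fromCommutativeRing seriesRing
  const-hom = record
    { ⟦_⟧    = const
    ; +-homo = λ a b n → ℤ.*-distribʳ-+ (𝟙 n) a b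
    ; *-homo = const-⊛-const
    ; -‿homo = λ a n → ≡.sym (ℤ.neg-distribˡ-* a (𝟙 n))
    ; 0-homo = λ _ → ≡.refl
    ; 1-homo = λ n → ℤ.*-identityˡ (𝟙 n)
    }

  const-≟ : ∀ a b → Maybe (const a ≈ const b)
  const-≟ a b with a ℤ.≟ b
  ... | yes ≡.refl = just (λ _ → ≡.refl)
  ... | no _       = nothing

  open import Algebra.Solver.Ring
    (AlmostCommutativeRing.rawRing (fromCommutativeRing ℤ.+-*-commutativeRing))
    (fromCommutativeRing seriesRing) const-hom const-≟
  open CommutativeRing seriesRing using (setoid; +-cong; *-cong) renaming (refl to ≈-refl; sym to ≈-sym)
  open import Relation.Binary.Reasoning.Setoid setoid

  infixl 6 _⊖_
  _⊖_ : Series → Series → Series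
  f ⊖ g = f ⊕ ⊖ g

  X : Series
  X 1 = 1ℤ
  X _ = 0ℤ

  -- Y solves the quadratic equation  Y + A B = x + A Y + Y B  satisfied by
  -- the avoidance series of a pattern with subtrees of series A and B.
  Solves : Series → Series → Series → Set
  Solves A B Y = Y ⊕ A ⊛ B ≈ X ⊕ A ⊛ Y ⊕ Y ⊛ B

  Solves-resp : ∀ {A A′ B B′ Y} → A ≈ A′ → B ≈ B′ → Solves A B Y → Solves A′ B′ Y
  Solves-resp {A} {A′} {B} {B′} {Y} A≈A′ B≈B′ Y-solves = begin
    Y ⊕ A′ ⊛ B′         ≈⟨ +-cong (≈-refl {Y}) (*-cong (≈-sym A≈A′) (≈-sym B≈B′)) ⟩
    Y ⊕ A ⊛ B           ≈⟨ Y-solves ⟩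
    X ⊕ A ⊛ Y ⊕ Y ⊛ B   ≈⟨ +-cong (+-cong (≈-refl {X}) (*-cong A≈A′ (≈-refl {Y}))) (*-cong (≈-refl {Y}) B≈B′) ⟩
    X ⊕ A′ ⊛ Y ⊕ Y ⊛ B′ ∎

  ≈⇒⊖≈𝟘 : ∀ {f g} → f ≈ g → f ⊖ g ≈ 𝟘
  ≈⇒⊖≈𝟘 {f} {g} f≈g = begin
    f ⊖ g ≈⟨ +-cong f≈g (≈-refl {⊖ g}) ⟩
    g ⊖ g ≈⟨ solve 1 (λ g → g :- g := con 0ℤ) ≈-refl g ⟩
    𝟘     ∎

  ⊖≈𝟘⇒≈ : ∀ {f g} → f ⊖ g ≈ 𝟘 → f ≈ g
  ⊖≈𝟘⇒≈ {f} {g} f-g≈𝟘 = begin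
    f           ≈⟨ solve 2 (λ f g → f := (f :- g) :+ g) ≈-refl f g ⟩
    (f ⊖ g) ⊕ g ≈⟨ +-cong f-g≈𝟘 (≈-refl {g}) ⟩
    𝟘 ⊕ g       ≈⟨ solve 1 (λ g → con 0ℤ :+ g := g) ≈-refl g ⟩
    g           ∎

  -- An identity  L = R + u₁ d₁ + u₂ d₂ (+ u₃ d₃)  with vanishing d's gives
  -- L = R: this is how the solver's identities are combined with hypotheses.
  combination₂-vanishes : ∀ {L R} u₁ u₂ d₁ d₂ →
    L ≈ R ⊕ (u₁ ⊛ d₁ ⊕ u₂ ⊛ d₂) → d₁ ≈ 𝟘 → d₂ ≈ 𝟘 → L ≈ R
  combination₂-vanishes {L} {R} u₁ u₂ d₁ d₂ L≈ d₁≈𝟘 d₂≈𝟘 = begin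
    L                         ≈⟨ L≈ ⟩
    R ⊕ (u₁ ⊛ d₁ ⊕ u₂ ⊛ d₂)  ≈⟨ +-cong (≈-refl {R}) (+-cong (*-cong (≈-refl {u₁}) d₁≈𝟘) (*-cong (≈-refl {u₂}) d₂≈𝟘)) ⟩
    R ⊕ (u₁ ⊛ 𝟘 ⊕ u₂ ⊛ 𝟘)    ≈⟨ solve 3 (λ R u₁ u₂ → R :+ (u₁ :* con 0ℤ :+ u₂ :* con 0ℤ) := R) ≈-refl R u₁ u₂ ⟩
    R                         ∎

  combination₃-vanishes : ∀ {L R} u₁ u₂ u₃ d₁ d₂ d₃ →
    L ≈ R ⊕ (u₁ ⊛ d₁ ⊕ u₂ ⊛ d₂ ⊕ u₃ ⊛ d₃) → d₁ ≈ 𝟘 → d₂ ≈ 𝟘 → d₃ ≈ 𝟘 → L ≈ R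
  combination₃-vanishes {L} {R} u₁ u₂ u₃ d₁ d₂ d₃ L≈ d₁≈𝟘 d₂≈𝟘 d₃≈𝟘 =
    combination₂-vanishes u₁ u₂ d₁ d₂ (begin
      L                                  ≈⟨ L≈ ⟩
      R ⊕ (u₁ ⊛ d₁ ⊕ u₂ ⊛ d₂ ⊕ u₃ ⊛ d₃) ≈⟨ +-cong (≈-refl {R}) (+-cong (≈-refl {u₁ ⊛ d₁ ⊕ u₂ ⊛ d₂}) (*-cong (≈-refl {u₃}) d₃≈𝟘)) ⟩
      R ⊕ (u₁ ⊛ d₁ ⊕ u₂ ⊛ d₂ ⊕ u₃ ⊛ 𝟘)  ≈⟨ solve 6 (λ R u₁ u₂ u₃ d₁ d₂ → R :+ (u₁ :* d₁ :+ u₂ :* d₂ :+ u₃ :* con 0ℤ)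
                                                      := R :+ (u₁ :* d₁ :+ u₂ :* d₂)) ≈-refl R u₁ u₂ u₃ d₁ d₂ ⟩
      R ⊕ (u₁ ⊛ d₁ ⊕ u₂ ⊛ d₂)            ∎)
      d₁≈𝟘 d₂≈𝟘

  ⊛-cancelˡ : ∀ u f g → u 0 ≡ 1ℤ → u ⊛ f ≈ u ⊛ g → f ≈ g
  ⊛-cancelˡ u f g u₀≡1 uf≈ug = ⊖≈𝟘⇒≈ (unit-not-zero-divisor u (f ⊖ g) u₀≡1 (begin
    u ⊛ (f ⊖ g)   ≈⟨ solve 3 (λ u f g → u :* (f :- g) := u :* f :- u :* g) ≈-refl u f g ⟩
    u ⊛ f ⊖ u ⊛ g ≈⟨ ≈⇒⊖≈𝟘 uf≈ug ⟩
    𝟘             ∎))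

  -- The equation has at most one solution: (1 - A - B)(Y - Z) = 0.
  solution-unique : ∀ A B Y Z → A 0 ≡ 0ℤ → B 0 ≡ 0ℤ → Solves A B Y → Solves A B Z → Y ≈ Z
  solution-unique A B Y Z A₀≡0 B₀≡0 Y-solves Z-solves =
    ⊛-cancelˡ (const 1ℤ ⊖ A ⊖ B) Y Z unit
      (combination₂-vanishes (const 1ℤ) (⊖ const 1ℤ) _ _
        (solve 5 (λ A B Y Z x → (con 1ℤ :- A :- B) :* Y :=
            (con 1ℤ :- A :- B) :* Z
            :+ (con 1ℤ :* (Y :+ A :* B :- (x :+ A :* Y :+ Y :* B))
            :+ (:- con 1ℤ) :* (Z :+ A :* B :- (x :+ A :* Z :+ Z :* B))))
          ≈-refl A B Y Z X)
        (≈⇒⊖≈𝟘 Y-solves) (≈⇒⊖≈𝟘 Z-solves))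
    where
    unit : (const 1ℤ ⊖ A ⊖ B) 0 ≡ 1ℤ
    unit rewrite A₀≡0 | B₀≡0 = ≡.refl

  solves-𝟘ʳ : ∀ A B Y → B ≈ 𝟘 → Solves A B Y → Y ≈ X ⊕ A ⊛ Y
  solves-𝟘ʳ A B Y B≈𝟘 Y-solves = combination₂-vanishes (const 1ℤ) (Y ⊖ A) _ B
    (solve 4 (λ A B Y x → Y := x :+ A :* Y
        :+ (con 1ℤ :* (Y :+ A :* B :- (x :+ A :* Y :+ Y :* B)) :+ (Y :- A) :* B))
      ≈-refl A B Y X)
    (≈⇒⊖≈𝟘 Y-solves) B≈𝟘

  𝟘ˡ-solves : ∀ A B Y → A ≈ 𝟘 → Y ≈ X ⊕ B ⊛ Y → Solves A B Y
  𝟘ˡ-solves A B Y A≈𝟘 Y≈ = combination₂-vanishes (B ⊖ Y) (const 1ℤ) A _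
    (solve 4 (λ A B Y x → Y :+ A :* B := x :+ A :* Y :+ Y :* B
        :+ ((B :- Y) :* A :+ con 1ℤ :* (Y :- (x :+ B :* Y))))
      ≈-refl A B Y X)
    A≈𝟘 (≈⇒⊖≈𝟘 Y≈)

  -- If a′ = x + a a′ and b′ = x + b b′, a solution for (a, b′) is also one
  -- for (a′, b): the two differ by multiples of the recurrences, and the
  -- common factor 1 - a cancels.
  solution-shift : ∀ a a′ b b′ C → a 0 ≡ 0ℤ → a′ ≈ X ⊕ a ⊛ a′ → b′ ≈ X ⊕ b ⊛ b′ →
                   Solves a b′ C → Solves a′ b C
  solution-shift a a′ b b′ C a₀≡0 a′-rec b′-rec C-solves =
    ⊛-cancelˡ (const 1ℤ ⊖ a) _ _ unit
      (combination₃-vanishes (b ⊖ C) (C ⊖ a) (const 1ℤ ⊖ b) _ _ _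
        (solve 6 (λ a a′ b b′ C x → (con 1ℤ :- a) :* (C :+ a′ :* b) :=
            (con 1ℤ :- a) :* (x :+ a′ :* C :+ C :* b)
            :+ ((b :- C) :* (a′ :- (x :+ a :* a′)) :+ (C :- a) :* (b′ :- (x :+ b :* b′))
            :+ (con 1ℤ :- b) :* ((C :+ a :* b′) :- (x :+ a :* C :+ C :* b′))))
          ≈-refl a a′ b b′ C X)
        (≈⇒⊖≈𝟘 a′-rec) (≈⇒⊖≈𝟘 b′-rec) (≈⇒⊖≈𝟘 C-solves))
    where
    unit : (const 1ℤ ⊖ a) 0 ≡ 1ℤ
    unit rewrite a₀≡0 = ≡.refl

  -- For a sequence c with c 0 = 0 and c (j+1) = x + c j · c (j+1) (the
  -- avoidance series of the left combs), c (p+q+1) solves the equation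
  -- for (c p, c q): shift p times starting from (c 0, c (p+q)).
  module _ (c : ℕ → Series) (c-const : ∀ j → c j 0 ≡ 0ℤ) (c₀≈𝟘 : c 0 ≈ 𝟘)
           (c-rec : ∀ j → c (suc j) ≈ X ⊕ c j ⊛ c (suc j)) where

    combs-solve : ∀ p q → Solves (c p) (c q) (c (suc (p +ℕ q)))
    combs-solve zero    q = 𝟘ˡ-solves (c 0) (c q) (c (suc q)) c₀≈𝟘 (c-rec q)
    combs-solve (suc p) q = solution-shift (c p) (c (suc p)) (c q) (c (suc q)) _
      (c-const p) (c-rec p) (c-rec q)
      (≡.subst (Solves (c p) (c (suc q))) (≡.cong (c ∘ suc) (ℕ.+-suc p q)) (combs-solve p (suc q)))

module Containment where

  open import Data.Bool using (f≤t; b≤b) renaming (_≤_ to _≤ᵇ_)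
  open import Data.Product using (_×_; _,_)
  open import Data.Sum using (_⊎_; inj₁; inj₂)
  open import Function.Bundles using (_⇔_; mk⇔)
  open import Relation.Nullary using (Dec; yes; no; does; ¬?)
  open import Data.Empty using (⊥-elim)
  open import Function using (_∘_)

  mutual
    embAt? : ∀ t T → Dec (EmbAt t T)
    embAt? leaf       T          = yes leafAt
    embAt? (node a b) leaf       = no λ ()
    embAt? (node a b) (node L R) with contains? L a | contains? R b
    ... | yes La | yes Rb = yes (nodeAt La Rb)
    ... | no ¬La | _      = no λ { (nodeAt La _) → ¬La La }
    ... | yes _  | no ¬Rb = no λ { (nodeAt _ Rb) → ¬Rb Rb }

    contains? : ∀ T t → Dec (Contains T t)
    contains? leaf t with embAt? t leaf
    ... | yes e = yes (here e)
    ... | no ¬e = no λ { (here e) → ¬e e }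
    contains? (node L R) t with embAt? t (node L R) | contains? L t | contains? R t
    ... | yes e | _     | _     = yes (here e)
    ... | no _  | yes c | _     = yes (left c)
    ... | no _  | no _  | yes c = yes (right c)
    ... | no ¬e | no ¬l | no ¬r = no λ { (here e) → ¬e e ; (left c) → ¬l c ; (right c) → ¬r c }

  avoids? : ∀ T t → Dec (Avoids T t)
  avoids? T t = ¬? (contains? T t)

  contains-leftPattern : ∀ {T a b} → Contains T (node a b) → Contains T a
  contains-leftPattern (here (nodeAt La _)) = left La
  contains-leftPattern (left c)             = left (contains-leftPattern c)
  contains-leftPattern (right c)            = right (contains-leftPattern c)

  contains-rightPattern : ∀ {T a b} → Contains T (node a b) → Contains T b
  contains-rightPattern (here (nodeAt _ Rb)) = right Rb
  contains-rightPattern (left c)             = left (contains-rightPattern c)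
  contains-rightPattern (right c)            = right (contains-rightPattern c)

  avoids-node : ∀ {L R a b} →
    Avoids (node L R) (node a b) ⇔ ((Avoids L (node a b) × Avoids R (node a b)) × (Avoids L a ⊎ Avoids R b))
  avoids-node {L} {R} {a} {b} = mk⇔ to from
    where
    Described : Set
    Described = (Avoids L (node a b) × Avoids R (node a b)) × (Avoids L a ⊎ Avoids R b)
    to : Avoids (node L R) (node a b) → Described
    to ¬c with contains? L a
    ... | yes La = (¬c ∘ left , ¬c ∘ right) , inj₂ λ Rb → ¬c (here (nodeAt La Rb))
    ... | no ¬La = (¬c ∘ left , ¬c ∘ right) , inj₁ ¬La
    from : Described → Avoids (node L R) (node a b)
    from ((¬l , _) , _)      (left c)                = ¬l c
    from ((_ , ¬r) , _)      (right c)               = ¬r c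
    from (_ , inj₁ ¬La)      (here (nodeAt La _))    = ¬La La
    from (_ , inj₂ ¬Rb)      (here (nodeAt _ Rb))    = ¬Rb Rb

  does-mono : ∀ {A B : Set} → (A → B) → (a? : Dec A) (b? : Dec B) → does a? ≤ᵇ does b?
  does-mono A→B (yes a) (yes b) = b≤b
  does-mono A→B (yes a) (no ¬b) = ⊥-elim (¬b (A→B a))
  does-mono A→B (no _)  (yes b) = f≤t
  does-mono A→B (no _)  (no _)  = b≤b

module Enumeration where

  open import Data.Nat using (ℕ; zero; suc; _+_; _≤_; _<_; s≤s; z≤n)
  import Data.Nat.Properties as ℕ
  open import Data.List using (List; []; _∷_; _++_; cartesianProductWith)
  open import Data.List.Membership.Propositional using (_∈_)
  open import Data.List.Membership.Propositional.Properties
    using (∈-++⁺ˡ; ∈-++⁺ʳ; ∈-++⁻; ∈-cartesianProductWith⁺; ∈-cartesianProductWith⁻)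
  open import Data.List.Relation.Unary.Any using (here)
  open import Data.List.Relation.Unary.AllPairs using ([]; _∷_)
  open import Data.List.Relation.Unary.All using ([])
  open import Data.List.Relation.Unary.Unique.Propositional using (Unique)
  import Data.List.Relation.Unary.Unique.Propositional.Properties as Unique
  open import Data.List.Properties using (cartesianProductWith-zeroʳ)
  open import Data.Product using (Σ-syntax; _×_; _,_)
  open import Data.Sum using (inj₁; inj₂)
  open import Relation.Nullary using (¬_)
  open import Relation.Binary.PropositionalEquality
  open import Function using (_∘_)

  leaves-positive : ∀ T → 1 ≤ leaves T
  leaves-positive leaf       = s≤s z≤n
  leaves-positive (node L R) = ℕ.≤-trans (leaves-positive L) (ℕ.m≤m+n (leaves L) (leaves R))

  node-injective : ∀ {L L′ R R′} → node L R ≡ node L′ R′ → L ≡ L′ × R ≡ R′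
  node-injective refl = refl , refl

  pairs : List Tree → List Tree → List Tree
  pairs = cartesianProductWith node

  joins : (ℕ → List Tree) → (ℕ → List Tree) → ℕ → List Tree
  joins F G zero    = pairs (F 0) (G 0)
  joins F G (suc n) = pairs (F 0) (G (suc n)) ++ joins (F ∘ suc) G n

  ∈-joins⁺ : ∀ F G p q {L R} → L ∈ F p → R ∈ G q → node L R ∈ joins F G (p + q)
  ∈-joins⁺ F G zero    zero    L∈ R∈ = ∈-cartesianProductWith⁺ node L∈ R∈
  ∈-joins⁺ F G zero    (suc q) L∈ R∈ = ∈-++⁺ˡ (∈-cartesianProductWith⁺ node L∈ R∈)
  ∈-joins⁺ F G (suc p) q       L∈ R∈ =
    ∈-++⁺ʳ (pairs (F 0) (G (suc (p + q)))) (∈-joins⁺ (F ∘ suc) G p q L∈ R∈)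

  ∈-joins⁻ : ∀ F G n {T} → T ∈ joins F G n →
             Σ[ p ∈ ℕ ] Σ[ q ∈ ℕ ] Σ[ L ∈ Tree ] Σ[ R ∈ Tree ]
               p + q ≡ n × L ∈ F p × R ∈ G q × T ≡ node L R
  ∈-joins⁻ F G zero T∈ with ∈-cartesianProductWith⁻ node (F 0) (G 0) T∈
  ... | L , R , L∈ , R∈ , T≡ = 0 , 0 , L , R , refl , L∈ , R∈ , T≡
  ∈-joins⁻ F G (suc n) T∈ with ∈-++⁻ (pairs (F 0) (G (suc n))) T∈
  ... | inj₁ T∈pairs with ∈-cartesianProductWith⁻ node (F 0) (G (suc n)) T∈pairs
  ...   | L , R , L∈ , R∈ , T≡ = 0 , suc n , L , R , refl , L∈ , R∈ , T≡
  ∈-joins⁻ F G (suc n) T∈ | inj₂ T∈rest with ∈-joins⁻ (F ∘ suc) G n T∈rest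
  ... | p , q , L , R , p+q≡n , L∈ , R∈ , T≡ = suc p , q , L , R , cong suc p+q≡n , L∈ , R∈ , T≡

  joins-unique : ∀ F G n → (∀ p → Unique (F p)) → (∀ q → Unique (G q)) →
                 (∀ {p p′ T} → T ∈ F p → T ∈ F p′ → p ≡ p′) → Unique (joins F G n)
  joins-unique F G zero    F! G! F-disjoint = Unique.cartesianProductWith⁺ node node-injective (F! 0) (G! 0)
  joins-unique F G (suc n) F! G! F-disjoint = Unique.++⁺
    (Unique.cartesianProductWith⁺ node node-injective (F! 0) (G! (suc n)))
    (joins-unique (F ∘ suc) G n (F! ∘ suc) G! (λ T∈ T∈′ → ℕ.suc-injective (F-disjoint T∈ T∈′)))
    disjoint
    where
    disjoint : ∀ {T} → ¬ (T ∈ pairs (F 0) (G (suc n)) × T ∈ joins (F ∘ suc) G n)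
    disjoint (T∈pairs , T∈rest)
      with ∈-cartesianProductWith⁻ node (F 0) (G (suc n)) T∈pairs | ∈-joins⁻ (F ∘ suc) G n T∈rest
    ... | L , R , L∈ , _ , refl | p , _ , _ , _ , _ , L∈′ , _ , T≡ with node-injective T≡
    ... | refl , refl with F-disjoint L∈ L∈′
    ... | ()

  leafAt1 : ℕ → List Tree
  leafAt1 1 = leaf ∷ []
  leafAt1 _ = []

  leafAt1-unique : ∀ n → Unique (leafAt1 n)
  leafAt1-unique 0             = []
  leafAt1-unique 1             = [] ∷ []
  leafAt1-unique (suc (suc n)) = []

  -- treesWithin f n lists the trees with n leaves, built with recursion depth f.
  treesWithin : ℕ → ℕ → List Tree
  treesWithin zero    n = []
  treesWithin (suc f) n = leafAt1 n ++ joins (treesWithin f) (treesWithin f) n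

  trees : ℕ → List Tree
  trees n = treesWithin n n

  treesWithin-leaves : ∀ f n {T} → T ∈ treesWithin f n → leaves T ≡ n
  treesWithin-leaves (suc f) n T∈ with ∈-++⁻ (leafAt1 n) T∈
  treesWithin-leaves (suc f) 1 T∈ | inj₁ (here refl) = refl
  ... | inj₂ T∈joins with ∈-joins⁻ (treesWithin f) (treesWithin f) n T∈joins
  ... | p , q , L , R , p+q≡n , L∈ , R∈ , refl =
    trans (cong₂ _+_ (treesWithin-leaves f p L∈) (treesWithin-leaves f q R∈)) p+q≡n

  treesWithin-complete : ∀ f T → leaves T ≤ f → T ∈ treesWithin f (leaves T)
  treesWithin-complete zero    T          T≤0 with ℕ.≤-trans (leaves-positive T) T≤0
  ... | ()
  treesWithin-complete (suc f) leaf       _   = here refl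
  treesWithin-complete (suc f) (node L R) T≤f = ∈-++⁺ʳ (leafAt1 (leaves L + leaves R))
    (∈-joins⁺ (treesWithin f) (treesWithin f) (leaves L) (leaves R)
      (treesWithin-complete f L (ℕ.≤-pred (ℕ.<-≤-trans (ℕ.m<m+n (leaves L) (leaves-positive R)) T≤f)))
      (treesWithin-complete f R (ℕ.≤-pred (ℕ.<-≤-trans (ℕ.m<n+m (leaves R) (leaves-positive L)) T≤f))))

  treesWithin-unique : ∀ f n → Unique (treesWithin f n)
  treesWithin-unique zero    n = []
  treesWithin-unique (suc f) n = Unique.++⁺ (leafAt1-unique n)
    (joins-unique (treesWithin f) (treesWithin f) n (treesWithin-unique f) (treesWithin-unique f)
      (λ T∈ T∈′ → trans (sym (treesWithin-leaves f _ T∈)) (treesWithin-leaves f _ T∈′)))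
    disjoint
    where
    disjoint : ∀ {T} → ¬ (T ∈ leafAt1 n × T ∈ joins (treesWithin f) (treesWithin f) n)
    disjoint {T} (T∈leaf , T∈joins) with ∈-joins⁻ (treesWithin f) (treesWithin f) n T∈joins
    disjoint {.(node L R)} (T∈leaf , _) | _ , _ , L , R , _ , _ , _ , refl = leaf≢node n T∈leaf
      where
      leaf≢node : ∀ n → ¬ (node L R ∈ leafAt1 n)
      leaf≢node 1 (here ())

  treesWithin-empty : ∀ f → treesWithin f 0 ≡ []
  treesWithin-empty zero    = refl
  treesWithin-empty (suc f) rewrite treesWithin-empty f = refl

  treesWithin-stable : ∀ f g n → n ≤ f → n ≤ g → treesWithin f n ≡ treesWithin g n
  treesWithin-stable zero    g       .zero z≤n _   = sym (treesWithin-empty g)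
  treesWithin-stable (suc f) zero    .zero _   z≤n = treesWithin-empty (suc f)
  treesWithin-stable (suc f) (suc g) n     n≤f n≤g =
    cong (leafAt1 n ++_) (joins-cong n (λ {p} {q} → same-pairs p q))
    where
    joins-cong : ∀ {F G F′ G′} n → (∀ {p q} → p + q ≡ n → pairs (F p) (G q) ≡ pairs (F′ p) (G′ q)) →
                 joins F G n ≡ joins F′ G′ n
    joins-cong zero    same = same refl
    joins-cong (suc n) same = cong₂ _++_ (same refl) (joins-cong n (same ∘ cong suc))
    -- both factors have fewer than n leaves unless the other one is empty
    same-pairs : ∀ p q → p + q ≡ n →
                 pairs (treesWithin f p) (treesWithin f q) ≡ pairs (treesWithin g p) (treesWithin g q)
    same-pairs zero    q       _ rewrite treesWithin-empty f | treesWithin-empty g = refl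
    same-pairs (suc p) zero    _ rewrite treesWithin-empty f | treesWithin-empty g =
      trans (cartesianProductWith-zeroʳ node (treesWithin f (suc p)))
            (sym (cartesianProductWith-zeroʳ node (treesWithin g (suc p))))
    same-pairs (suc p) (suc q) p+q≡n = cong₂ pairs
      (treesWithin-stable f g (suc p) (below p<n n≤f) (below p<n n≤g))
      (treesWithin-stable f g (suc q) (below q<n n≤f) (below q<n n≤g))
      where
      p<n : suc p < n
      p<n = subst (suc p <_) p+q≡n (ℕ.m<m+n (suc p) (s≤s z≤n))
      q<n : suc q < n
      q<n = subst (suc q <_) p+q≡n (ℕ.m<n+m (suc q) (s≤s z≤n))
      below : ∀ {m k} → m < n → n ≤ suc k → m ≤ k
      below m<n n≤k = ℕ.≤-pred (ℕ.<-≤-trans m<n n≤k)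

  size : Tree → ℕ
  size leaf       = 0
  size (node L R) = suc (size L + size R)

  leaves≡suc-size : ∀ T → leaves T ≡ suc (size T)
  leaves≡suc-size leaf       = refl
  leaves≡suc-size (node L R) rewrite leaves≡suc-size L | leaves≡suc-size R = cong suc (ℕ.+-suc (size L) (size R))

module Counting where

  open Containment
  open Enumeration
  open import Data.Bool using (Bool; true; false; _∧_; _∨_; f≤t; b≤b) renaming (_≤_ to _≤ᵇ_)
  open import Data.Nat using (ℕ; zero; suc; _+_; _*_; _<_; s≤s; z≤n)
  import Data.Nat.Properties as ℕ
  open import Algebra.Properties.CommutativeSemigroup ℕ.+-commutativeSemigroup
    using (interchange)
  open import Data.List using (List; []; _∷_; _++_; map; filter; length)
  open import Relation.Nullary using (Dec; yes; no; does)
  open import Relation.Nullary.Decidable using (does-⇔; _×-dec_; _⊎-dec_)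
  open import Relation.Binary.PropositionalEquality
  open import Function using (_∘_)
  open ≡-Reasoning

  toℕ : Bool → ℕ
  toℕ false = 0
  toℕ true  = 1

  -- The inclusion–exclusion identity behind the functional equation, for
  -- truth values with α → γ and β → δ.
  indicator-identity : ∀ {α β γ δ} → α ≤ᵇ γ → β ≤ᵇ δ →
    toℕ ((γ ∧ δ) ∧ (α ∨ β)) + toℕ α * toℕ β ≡ toℕ α * toℕ δ + toℕ γ * toℕ β
  indicator-identity {false} {false} f≤t f≤t = refl
  indicator-identity {false} {false} f≤t b≤b = refl
  indicator-identity {false} {true}  f≤t b≤b = refl
  indicator-identity {false} {false} b≤b f≤t = refl
  indicator-identity {true}  {false} b≤b f≤t = refl
  indicator-identity {false} {false} b≤b b≤b = refl
  indicator-identity {false} {true}  b≤b b≤b = refl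
  indicator-identity {true}  {false} b≤b b≤b = refl
  indicator-identity {true}  {true}  b≤b b≤b = refl

  sumOver : {A : Set} → (A → ℕ) → List A → ℕ
  sumOver f []       = 0
  sumOver f (x ∷ xs) = f x + sumOver f xs

  sumOver-++ : ∀ {A : Set} (f : A → ℕ) xs ys → sumOver f (xs ++ ys) ≡ sumOver f xs + sumOver f ys
  sumOver-++ f []       ys = refl
  sumOver-++ f (x ∷ xs) ys = trans (cong (f x +_) (sumOver-++ f xs ys)) (sym (ℕ.+-assoc (f x) _ _))

  sumOver-cong : ∀ {A : Set} {f g : A → ℕ} xs → (∀ x → f x ≡ g x) → sumOver f xs ≡ sumOver g xs
  sumOver-cong []       f≗g = refl
  sumOver-cong (x ∷ xs) f≗g = cong₂ _+_ (f≗g x) (sumOver-cong xs f≗g)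

  sumOver-+ : ∀ {A : Set} (f g : A → ℕ) xs → sumOver (λ x → f x + g x) xs ≡ sumOver f xs + sumOver g xs
  sumOver-+ f g []       = refl
  sumOver-+ f g (x ∷ xs) = trans (cong (f x + g x +_) (sumOver-+ f g xs)) (interchange (f x) (g x) _ _)

  sumOver-*ˡ : ∀ {A : Set} c (f : A → ℕ) xs → sumOver (λ x → c * f x) xs ≡ c * sumOver f xs
  sumOver-*ˡ c f []       = sym (ℕ.*-zeroʳ c)
  sumOver-*ˡ c f (x ∷ xs) = trans (cong (c * f x +_) (sumOver-*ˡ c f xs)) (sym (ℕ.*-distribˡ-+ c (f x) _))

  ΣΣ : {A B : Set} → (A → B → ℕ) → List A → List B → ℕ
  ΣΣ h xs ys = sumOver (λ x → sumOver (h x) ys) xs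

  ΣΣ-+ : ∀ {A B : Set} (h k : A → B → ℕ) xs ys →
         ΣΣ (λ x y → h x y + k x y) xs ys ≡ ΣΣ h xs ys + ΣΣ k xs ys
  ΣΣ-+ h k xs ys = trans (sumOver-cong xs (λ x → sumOver-+ (h x) (k x) ys)) (sumOver-+ _ _ xs)

  ΣΣ-product : ∀ {A B : Set} (f : A → ℕ) (g : B → ℕ) xs ys →
               ΣΣ (λ x y → f x * g y) xs ys ≡ sumOver f xs * sumOver g ys
  ΣΣ-product f g xs ys = begin
    sumOver (λ x → sumOver (λ y → f x * g y) ys) xs ≡⟨ sumOver-cong xs (λ x → sumOver-*ˡ (f x) g ys) ⟩
    sumOver (λ x → f x * sumOver g ys) xs           ≡⟨ sumOver-cong xs (λ x → ℕ.*-comm (f x) _) ⟩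
    sumOver (λ x → sumOver g ys * f x) xs           ≡⟨ sumOver-*ˡ (sumOver g ys) f xs ⟩
    sumOver g ys * sumOver f xs                     ≡⟨ ℕ.*-comm (sumOver g ys) _ ⟩
    sumOver f xs * sumOver g ys                     ∎

  sumOver-pairs : ∀ (h : Tree → ℕ) xs ys → sumOver h (pairs xs ys) ≡ ΣΣ (λ L R → h (node L R)) xs ys
  sumOver-pairs h []       ys = refl
  sumOver-pairs h (x ∷ xs) ys = begin
    sumOver h (map (node x) ys ++ pairs xs ys)         ≡⟨ sumOver-++ h (map (node x) ys) (pairs xs ys) ⟩
    sumOver h (map (node x) ys) + sumOver h (pairs xs ys) ≡⟨ cong₂ _+_ (over-map ys) (sumOver-pairs h xs ys) ⟩
    ΣΣ (λ L R → h (node L R)) (x ∷ xs) ys              ∎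
    where
    over-map : ∀ ys → sumOver h (map (node x) ys) ≡ sumOver (h ∘ node x) ys
    over-map []       = refl
    over-map (y ∷ ys) = cong (h (node x y) +_) (over-map ys)

  length-filter : ∀ {A : Set} {P : A → Set} (P? : ∀ x → Dec (P x)) xs →
                  length (filter P? xs) ≡ sumOver (toℕ ∘ does ∘ P?) xs
  length-filter P? []       = refl
  length-filter P? (x ∷ xs) with P? x
  ... | yes _ = cong suc (length-filter P? xs)
  ... | no _  = length-filter P? xs

  indicator : Tree → Tree → ℕ
  indicator t T = toℕ (does (avoids? T t))

  avoidersIn : Tree → (ℕ → List Tree) → ℕ → ℕ
  avoidersIn s H p = sumOver (indicator s) (H p)

  count : Tree → ℕ → ℕ
  count t = avoidersIn t trees

  indicator-node : ∀ a b L R →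
    indicator (node a b) (node L R) + indicator a L * indicator b R
      ≡ indicator a L * indicator (node a b) R + indicator (node a b) L * indicator b R
  indicator-node a b L R = begin
    toℕ (does τ?) + α * β                                   ≡⟨ cong (λ z → toℕ z + α * β) τ≡ ⟩
    toℕ ((does γ? ∧ does δ?) ∧ (does α? ∨ does β?)) + α * β ≡⟨ indicator-identity α≤γ β≤δ ⟩
    α * toℕ (does δ?) + toℕ (does γ?) * β                   ∎
    where
    α? = avoids? L a
    β? = avoids? R b
    γ? = avoids? L (node a b)
    δ? = avoids? R (node a b)
    τ? = avoids? (node L R) (node a b)
    α = toℕ (does α?)
    β = toℕ (does β?)
    τ≡ = does-⇔ avoids-node τ? ((γ? ×-dec δ?) ×-dec (α? ⊎-dec β?))
    α≤γ = does-mono (λ ¬La c → ¬La (contains-leftPattern c)) α? γ?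
    β≤δ = does-mono (λ ¬Rb c → ¬Rb (contains-rightPattern c)) β? δ?

  pairs-identity : ∀ a b xs ys → let t = node a b in
    sumOver (indicator t) (pairs xs ys) + sumOver (indicator a) xs * sumOver (indicator b) ys
      ≡ sumOver (indicator a) xs * sumOver (indicator t) ys + sumOver (indicator t) xs * sumOver (indicator b) ys
  pairs-identity a b xs ys = begin
    sumOver (ι t) (pairs xs ys) + sumOver (ι a) xs * sumOver (ι b) ys
      ≡⟨ cong₂ _+_ (sumOver-pairs (ι t) xs ys) (sym (ΣΣ-product (ι a) (ι b) xs ys)) ⟩
    ΣΣ (λ L R → ι t (node L R)) xs ys + ΣΣ (λ L R → ι a L * ι b R) xs ys
      ≡⟨ sym (ΣΣ-+ _ _ xs ys) ⟩
    ΣΣ (λ L R → ι t (node L R) + ι a L * ι b R) xs ys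
      ≡⟨ sumOver-cong xs (λ L → sumOver-cong ys (indicator-node a b L)) ⟩
    ΣΣ (λ L R → ι a L * ι t R + ι t L * ι b R) xs ys
      ≡⟨ ΣΣ-+ _ _ xs ys ⟩
    ΣΣ (λ L R → ι a L * ι t R) xs ys + ΣΣ (λ L R → ι t L * ι b R) xs ys
      ≡⟨ cong₂ _+_ (ΣΣ-product (ι a) (ι t) xs ys) (ΣΣ-product (ι t) (ι b) xs ys) ⟩
    sumOver (ι a) xs * sumOver (ι t) ys + sumOver (ι t) xs * sumOver (ι b) ys ∎
    where
    t = node a b
    ι = indicator

  infixl 7 _⋆_
  _⋆_ : (ℕ → ℕ) → (ℕ → ℕ) → ℕ → ℕ
  (f ⋆ g) zero    = f 0 * g 0
  (f ⋆ g) (suc n) = f 0 * g (suc n) + ((f ∘ suc) ⋆ g) n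

  ⋆-cong : ∀ {f g f′ g′} n → (∀ {p q} → p + q ≡ n → f p * g q ≡ f′ p * g′ q) → (f ⋆ g) n ≡ (f′ ⋆ g′) n
  ⋆-cong zero    same = same refl
  ⋆-cong (suc n) same = cong₂ _+_ (same refl) (⋆-cong n (same ∘ cong suc))

  joins-identity : ∀ a b F G n → let t = node a b in
    sumOver (indicator t) (joins F G n) + (avoidersIn a F ⋆ avoidersIn b G) n
      ≡ (avoidersIn a F ⋆ avoidersIn t G) n + (avoidersIn t F ⋆ avoidersIn b G) n
  joins-identity a b F G zero    = pairs-identity a b (F 0) (G 0)
  joins-identity a b F G (suc n) = begin
    sumOver (ι t) (pairs (F 0) (G (suc n)) ++ joins (F ∘ suc) G n) + (Σ a F ⋆ Σ b G) (suc n)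
      ≡⟨ cong (_+ (Σ a F ⋆ Σ b G) (suc n)) (sumOver-++ (ι t) (pairs (F 0) (G (suc n))) _) ⟩
    (sumOver (ι t) (pairs (F 0) (G (suc n))) + sumOver (ι t) (joins (F ∘ suc) G n))
      + (Σ a F 0 * Σ b G (suc n) + (Σ a (F ∘ suc) ⋆ Σ b G) n)
      ≡⟨ interchange (sumOver (ι t) (pairs (F 0) (G (suc n)))) _ _ _ ⟩
    (sumOver (ι t) (pairs (F 0) (G (suc n))) + Σ a F 0 * Σ b G (suc n))
      + (sumOver (ι t) (joins (F ∘ suc) G n) + (Σ a (F ∘ suc) ⋆ Σ b G) n)
      ≡⟨ cong₂ _+_ (pairs-identity a b (F 0) (G (suc n))) (joins-identity a b (F ∘ suc) G n) ⟩
    (Σ a F 0 * Σ t G (suc n) + Σ t F 0 * Σ b G (suc n))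
      + ((Σ a (F ∘ suc) ⋆ Σ t G) n + (Σ t (F ∘ suc) ⋆ Σ b G) n)
      ≡⟨ interchange (Σ a F 0 * Σ t G (suc n)) _ _ _ ⟩
    (Σ a F ⋆ Σ t G) (suc n) + (Σ t F ⋆ Σ b G) (suc n) ∎
    where
    t = node a b
    ι = indicator
    Σ = avoidersIn

  x-coeff : ℕ → ℕ
  x-coeff 1 = 1
  x-coeff _ = 0

  -- In degree m + 1 the lists of depth m give the correct counts: a factor
  -- with m + 1 leaves is always paired with the empty list of 0-leaf trees.
  depth-suffices : ∀ s u m {p q} → p + q ≡ suc m →
    avoidersIn s (treesWithin m) p * avoidersIn u (treesWithin m) q ≡ count s p * count u q
  depth-suffices s u m {zero}  {q}     _ rewrite treesWithin-empty m = refl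
  depth-suffices s u m {suc p} {zero}  _ rewrite treesWithin-empty m =
    trans (ℕ.*-zeroʳ (avoidersIn s (treesWithin m) (suc p))) (sym (ℕ.*-zeroʳ (count s (suc p))))
  depth-suffices s u m {suc p} {suc q} p+q≡ = cong₂ _*_
    (cong (sumOver (indicator s)) (treesWithin-stable m (suc p) (suc p) p≤m ℕ.≤-refl))
    (cong (sumOver (indicator u)) (treesWithin-stable m (suc q) (suc q) q≤m ℕ.≤-refl))
    where
    p≤m = ℕ.≤-pred (subst (suc p <_) p+q≡ (ℕ.m<m+n (suc p) (s≤s z≤n)))
    q≤m = ℕ.≤-pred (subst (suc q <_) p+q≡ (ℕ.m<n+m (suc q) (s≤s z≤n)))

  count-equation : ∀ a b n → let t = node a b in
    count t n + (count a ⋆ count b) n ≡ x-coeff n + (count a ⋆ count t) n + (count t ⋆ count b) n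
  count-equation a b zero    = refl
  count-equation a b (suc m) = begin
    count t (suc m) + (count a ⋆ count b) (suc m)
      ≡⟨ cong₂ _+_ (sumOver-++ (indicator t) (leafAt1 (suc m)) (joins W W (suc m))) (sym (shallow a b)) ⟩
    (sumOver (indicator t) (leafAt1 (suc m)) + sumOver (indicator t) (joins W W (suc m)))
      + (avoidersIn a W ⋆ avoidersIn b W) (suc m)
      ≡⟨ ℕ.+-assoc (sumOver (indicator t) (leafAt1 (suc m))) _ _ ⟩
    sumOver (indicator t) (leafAt1 (suc m))
      + (sumOver (indicator t) (joins W W (suc m)) + (avoidersIn a W ⋆ avoidersIn b W) (suc m))
      ≡⟨ cong₂ _+_ (leaf-term m) (joins-identity a b W W (suc m)) ⟩
    x-coeff (suc m) + ((avoidersIn a W ⋆ avoidersIn t W) (suc m) + (avoidersIn t W ⋆ avoidersIn b W) (suc m))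
      ≡⟨ cong (x-coeff (suc m) +_) (cong₂ _+_ (shallow a t) (shallow t b)) ⟩
    x-coeff (suc m) + ((count a ⋆ count t) (suc m) + (count t ⋆ count b) (suc m))
      ≡⟨ ℕ.+-assoc (x-coeff (suc m)) _ _ ⟨
    x-coeff (suc m) + (count a ⋆ count t) (suc m) + (count t ⋆ count b) (suc m) ∎
    where
    t = node a b
    W = treesWithin m
    shallow : ∀ s u → (avoidersIn s W ⋆ avoidersIn u W) (suc m) ≡ (count s ⋆ count u) (suc m)
    shallow s u = ⋆-cong {avoidersIn s W} {avoidersIn u W} {count s} {count u} (suc m) (depth-suffices s u m)
    -- the leaf avoids node a b
    leaf-term : ∀ m → sumOver (indicator t) (leafAt1 (suc m)) ≡ x-coeff (suc m)
    leaf-term zero    = refl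
    leaf-term (suc m) = refl

module WilfEquivalence where

  open PowerSeries
  open SeriesAlgebra
  open Counting
  open Enumeration using (size; trees)
  open import Data.Nat using (ℕ; zero; suc) renaming (_+_ to _+ℕ_; _*_ to _*ℕ_)
  open import Data.Integer using (_+_; _*_)
  open import Agda.Builtin.Int using (pos)
  import Data.Integer.Properties as ℤ
  open import Data.List using ([]; _∷_)
  open import Relation.Binary.PropositionalEquality
  open import Function using (_∘_)
  open ≡-Reasoning

  avSeries : Tree → Series
  avSeries t n = pos (count t n)

  pos-⋆ : ∀ f g n → ((pos ∘ f) ⊛ (pos ∘ g)) n ≡ pos ((f ⋆ g) n)
  pos-⋆ f g zero    = sym (ℤ.pos-* (f 0) (g 0))
  pos-⋆ f g (suc n) = begin
    pos (f 0) * pos (g (suc n)) + ((pos ∘ f ∘ suc) ⊛ (pos ∘ g)) n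
      ≡⟨ cong₂ _+_ (sym (ℤ.pos-* (f 0) (g (suc n)))) (pos-⋆ (f ∘ suc) g n) ⟩
    pos (f 0 *ℕ g (suc n)) + pos (((f ∘ suc) ⋆ g) n)
      ≡⟨ sym (ℤ.pos-+ (f 0 *ℕ g (suc n)) _) ⟩
    pos ((f ⋆ g) (suc n)) ∎

  x-coeff-series : ∀ n → X n ≡ pos (x-coeff n)
  x-coeff-series 0             = refl
  x-coeff-series 1             = refl
  x-coeff-series (suc (suc n)) = refl

  avSeries-solves : ∀ a b → Solves (avSeries a) (avSeries b) (avSeries (node a b))
  avSeries-solves a b n = begin
    pos (count t n) + (A a ⊛ A b) n
      ≡⟨ cong (pos (count t n) +_) (pos-⋆ (count a) (count b) n) ⟩
    pos (count t n) + pos ((count a ⋆ count b) n)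
      ≡⟨ sym (ℤ.pos-+ (count t n) _) ⟩
    pos (count t n +ℕ (count a ⋆ count b) n)
      ≡⟨ cong pos (count-equation a b n) ⟩
    pos (x-coeff n +ℕ (count a ⋆ count t) n +ℕ (count t ⋆ count b) n)
      ≡⟨ trans (ℤ.pos-+ (x-coeff n +ℕ _) _) (cong (_+ pos ((count t ⋆ count b) n)) (ℤ.pos-+ (x-coeff n) _)) ⟩
    pos (x-coeff n) + pos ((count a ⋆ count t) n) + pos ((count t ⋆ count b) n)
      ≡⟨ cong₂ _+_ (cong₂ _+_ (sym (x-coeff-series n)) (sym (pos-⋆ (count a) (count t) n)))
                   (sym (pos-⋆ (count t) (count b) n)) ⟩
    (X ⊕ A a ⊛ A t ⊕ A t ⊛ A b) n ∎
    where
    t = node a b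
    A = avSeries

  comb : ℕ → Tree
  comb zero    = leaf
  comb (suc j) = node (comb j) leaf

  -- Every tree contains the one-leaf pattern.
  avSeries-leaf : avSeries leaf ≈ 𝟘
  avSeries-leaf n = cong pos (sumOver-zero (trees n))
    where
    sumOver-zero : ∀ Ts → sumOver (indicator leaf) Ts ≡ 0
    sumOver-zero []              = refl
    sumOver-zero (leaf     ∷ Ts) = sumOver-zero Ts
    sumOver-zero (node _ _ ∷ Ts) = sumOver-zero Ts

  combSeries : ℕ → Series
  combSeries j = avSeries (comb j)

  -- c (j+1) = x + c j · c (j+1): the equation for comb (j+1) = node (comb j) leaf.
  combSeries-rec : ∀ j → combSeries (suc j) ≈ X ⊕ combSeries j ⊛ combSeries (suc j)
  combSeries-rec j = solves-𝟘ʳ (combSeries j) (avSeries leaf) (combSeries (suc j))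
    avSeries-leaf (avSeries-solves (comb j) leaf)

  -- For t =
  -- node a b both avSeries t and combSeries (size t) solve the equation
  -- with coefficients combSeries (size a) and combSeries (size b), and the
  -- solution is unique.
  avSeries-comb : ∀ t → avSeries t ≈ combSeries (size t)
  avSeries-comb leaf       = λ _ → refl
  avSeries-comb (node a b) = solution-unique (combSeries p) (combSeries q) _ _ refl refl
    (Solves-resp (avSeries-comb a) (avSeries-comb b) (avSeries-solves a b))
    (combs-solve combSeries (λ _ → refl) avSeries-leaf combSeries-rec p q)
    where
    p = size a
    q = size b

  count-comb : ∀ t n → count t n ≡ count (comb (size t)) n
  count-comb t n = ℤ.+-injective (avSeries-comb t n)

module Permutations where

  open Enumeration using (size)
  open WilfEquivalence using (comb)
  open import Data.Nat using (ℕ; zero; suc; _+_; _≤_; _<_; s≤s; z≤n; _∸_; _⊔_; _<?_)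
  open import Data.Nat.Induction using (<-rec)
  open import Data.Fin using (cast) renaming (zero to fzero; suc to fsuc)
  import Data.Nat.Properties as ℕ
  open import Data.List using (List; []; _∷_; _++_; map; filter; length; lookup; upTo; applyUpTo)
  import Data.List.Properties as List
  open import Data.List.Membership.Propositional using (_∈_)
  open import Data.List.Membership.Propositional.Properties using (∈-++⁻)
  open import Data.List.Relation.Unary.Any using (here; there)
  open import Data.List.Relation.Unary.All as All using (All; []; _∷_)
  open import Data.List.Relation.Binary.Sublist.Propositional
    using (_⊆_; []; _∷_; _∷ʳ_; minimum; ⊆-trans; to∈; from∈) renaming (lookup to ⊆-lookup)
  open import Data.List.Relation.Binary.Sublist.Propositional.Properties
    using (++⁺ˡ; ++⁺ʳ; filter-⊆)
  open import Data.List.Relation.Binary.Permutation.Propositional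
    using (_↭_; ↭-sym; ↭-refl; prep; module PermutationReasoning)
  import Data.List.Relation.Binary.Permutation.Propositional.Properties as Perm
  open import Data.Product using (Σ-syntax; _×_; _,_; proj₁; proj₂)
  open import Data.Sum using (_⊎_; inj₁; inj₂; [_,_]′)
  open import Data.Empty using (⊥; ⊥-elim)
  open import Relation.Nullary using (¬_)
  open import Relation.Binary.PropositionalEquality
  open import Function using (_∘_)
  open import Function.Bundles using (_⇔_; mk⇔; Equivalence)
  open Equivalence using (from)

  interval : ℕ → ℕ → List ℕ
  interval lo zero    = []
  interval lo (suc m) = lo ∷ interval (suc lo) m

  ∈-interval : ∀ lo m {x} → x ∈ interval lo m → lo ≤ x × x < lo + m
  ∈-interval lo (suc m) (here refl) = ℕ.≤-refl , ℕ.m<m+n lo (s≤s z≤n)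
  ∈-interval lo (suc m) {x} (there x∈) with ∈-interval (suc lo) m x∈
  ... | lo<x , x<lo+m = ℕ.<⇒≤ lo<x , subst (x <_) (sym (ℕ.+-suc lo m)) x<lo+m

  interval-split : ∀ lo a b → interval lo (a + suc b) ≡ interval lo a ++ (lo + a) ∷ interval (suc (lo + a)) b
  interval-split lo zero    b rewrite ℕ.+-identityʳ lo = refl
  interval-split lo (suc a) b rewrite ℕ.+-suc lo a     = cong (lo ∷_) (interval-split (suc lo) a b)

  -- S(n) in Defs is stated with map suc (upTo n), which is interval 1 n.
  interval-from-1 : ∀ n → map suc (upTo n) ≡ interval 1 n
  interval-from-1 n = trans (List.map-applyUpTo (λ i → i) suc n) (applyUpTo-interval 1 n (λ _ → refl))
    where
    applyUpTo-interval : ∀ {f} lo n → (∀ i → f i ≡ lo + i) → applyUpTo f n ≡ interval lo n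
    applyUpTo-interval lo zero    f≗ = refl
    applyUpTo-interval lo (suc n) f≗ = cong₂ _∷_ (trans (f≗ 0) (ℕ.+-identityʳ lo))
      (applyUpTo-interval (suc lo) n (λ i → trans (f≗ (suc i)) (ℕ.+-suc lo i)))

  toPerm : Tree → ℕ → List ℕ
  toPerm leaf       lo = []
  toPerm (node L R) lo = (lo + size L) ∷ (toPerm L lo ++ toPerm R (suc (lo + size L)))

  length-toPerm : ∀ T lo → length (toPerm T lo) ≡ size T
  length-toPerm leaf       lo = refl
  length-toPerm (node L R) lo = cong suc (trans (List.length-++ (toPerm L lo))
    (cong₂ _+_ (length-toPerm L lo) (length-toPerm R _)))

  toPerm-↭ : ∀ T lo → toPerm T lo ↭ interval lo (size T)
  toPerm-↭ leaf       lo = ↭-refl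
  toPerm-↭ (node L R) lo = begin
    v ∷ (toPerm L lo ++ toPerm R (suc v))       ↭⟨ ↭-sym (Perm.shift v (toPerm L lo) _) ⟩
    toPerm L lo ++ v ∷ toPerm R (suc v)         ↭⟨ Perm.++⁺ (toPerm-↭ L lo) (prep v (toPerm-↭ R (suc v))) ⟩
    interval lo (size L) ++ v ∷ interval (suc v) (size R)
                                                ≡⟨ interval-split lo (size L) (size R) ⟨
    interval lo (size L + suc (size R))         ≡⟨ cong (interval lo) (ℕ.+-suc (size L) (size R)) ⟩
    interval lo (size (node L R))               ∎
    where
    open PermutationReasoning
    v = lo + size L

  toPerm-bounds : ∀ T lo {x} → x ∈ toPerm T lo → lo ≤ x × x < lo + size T
  toPerm-bounds T lo x∈ = ∈-interval lo (size T) (Perm.∈-resp-↭ (toPerm-↭ T lo) x∈)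

  ++-equal-length : ∀ (xs xs′ : List ℕ) {ys ys′} → length xs ≡ length xs′ → xs ++ ys ≡ xs′ ++ ys′ →
                    xs ≡ xs′ × ys ≡ ys′
  ++-equal-length []       []         _   eq = refl , eq
  ++-equal-length (x ∷ xs) (x′ ∷ xs′) len eq with List.∷-injective eq
  ... | refl , eq′ with ++-equal-length xs xs′ (ℕ.suc-injective len) eq′
  ... | refl , ys≡ = refl , ys≡

  -- Trees are recovered from their permutations: the root value fixes size L.
  toPerm-injective : ∀ T T′ lo → toPerm T lo ≡ toPerm T′ lo → T ≡ T′
  toPerm-injective leaf       leaf         lo eq = refl
  toPerm-injective (node L R) (node L′ R′) lo eq with List.∷-injective eq
  ... | root≡ , rest≡ with ℕ.+-cancelˡ-≡ lo (size L) (size L′) root≡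
  ... | size≡ with ++-equal-length (toPerm L lo) (toPerm L′ lo)
                     (trans (length-toPerm L lo) (trans size≡ (sym (length-toPerm L′ lo)))) rest≡
  ... | L≡ , R≡ rewrite size≡ = cong₂ node (toPerm-injective L L′ lo L≡) (toPerm-injective R R′ _ R≡)

  Has231 : List ℕ → Set
  Has231 π = Σ[ b ∈ ℕ ] Σ[ c ∈ ℕ ] Σ[ a ∈ ℕ ] (b ∷ c ∷ a ∷ []) ⊆ π × a < b × b < c

  data Decreasing : List ℕ → Set where
    []  : Decreasing []
    [_] : ∀ x → Decreasing (x ∷ [])
    _∷_ : ∀ {x y ys} → y < x → Decreasing (y ∷ ys) → Decreasing (x ∷ y ∷ ys)

  Decreasing-tail : ∀ {x ys} → Decreasing (x ∷ ys) → Decreasing ys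
  Decreasing-tail [ x ]     = []
  Decreasing-tail (_ ∷ dec) = dec

  HasDecreasing : ℕ → List ℕ → Set
  HasDecreasing j π = Σ[ ys ∈ List ℕ ] ys ⊆ π × length ys ≡ j × Decreasing ys

  -- The largest number of left steps on a path down from the root; it is
  -- the size of the largest comb contained in T.
  leftDepth : Tree → ℕ
  leftDepth leaf       = 0
  leftDepth (node L R) = suc (leftDepth L) ⊔ leftDepth R

  ≤-⊔-cases : ∀ {x} m n → x ≤ m ⊔ n → x ≤ m ⊎ x ≤ n
  ≤-⊔-cases {x} m n x≤ with ℕ.⊔-sel m n
  ... | inj₁ m⊔n≡m = inj₁ (subst (x ≤_) m⊔n≡m x≤)
  ... | inj₂ m⊔n≡n = inj₂ (subst (x ≤_) m⊔n≡n x≤)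

  contains-comb⇒ : ∀ T j → Contains T (comb j) → j ≤ leftDepth T
  contains-comb⇒ T          zero    _                 = z≤n
  contains-comb⇒ leaf       (suc j) (here ())
  contains-comb⇒ (node L R) (suc j) (here (nodeAt c _)) =
    ℕ.≤-trans (s≤s (contains-comb⇒ L j c)) (ℕ.m≤m⊔n (suc (leftDepth L)) (leftDepth R))
  contains-comb⇒ (node L R) (suc j) (left c)  =
    ℕ.≤-trans (ℕ.m≤n⇒m≤1+n (contains-comb⇒ L (suc j) c)) (ℕ.m≤m⊔n (suc (leftDepth L)) (leftDepth R))
  contains-comb⇒ (node L R) (suc j) (right c) =
    ℕ.≤-trans (contains-comb⇒ R (suc j) c) (ℕ.m≤n⊔m (suc (leftDepth L)) (leftDepth R))

  contains-comb⇐ : ∀ T j → j ≤ leftDepth T → Contains T (comb j)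
  contains-comb⇐ T          zero    _  = here leafAt
  contains-comb⇐ (node L R) (suc j) j≤ with ≤-⊔-cases (suc (leftDepth L)) (leftDepth R) j≤
  ... | inj₁ j≤L = here (nodeAt (contains-comb⇐ L j (ℕ.≤-pred j≤L)) (here leafAt))
  ... | inj₂ j≤R = right (contains-comb⇐ R (suc j) j≤R)

  ⊆-++-split : ∀ (xs : List ℕ) {ys zs} → zs ⊆ xs ++ ys →
               Σ[ zs₁ ∈ List ℕ ] Σ[ zs₂ ∈ List ℕ ] zs ≡ zs₁ ++ zs₂ × zs₁ ⊆ xs × zs₂ ⊆ ys
  ⊆-++-split []       {zs = zs} sub = [] , zs , refl , [] , sub
  ⊆-++-split (x ∷ xs) (.x ∷ʳ sub) with ⊆-++-split xs sub
  ... | zs₁ , zs₂ , refl , sub₁ , sub₂ = zs₁ , zs₂ , refl , x ∷ʳ sub₁ , sub₂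
  ⊆-++-split (x ∷ xs) (refl ∷ sub) with ⊆-++-split xs sub
  ... | zs₁ , zs₂ , refl , sub₁ , sub₂ = x ∷ zs₁ , zs₂ , refl , refl ∷ sub₁ , sub₂

  -- v followed by the smaller values α and then the larger values β avoids
  -- 231 if α and β do: an occurrence cannot use v (nothing larger than v
  -- precedes a smaller value) nor straddle α and β.
  231-free-join : ∀ v α β → All (_< v) α → All (v <_) β → ¬ Has231 α → ¬ Has231 β → ¬ Has231 (v ∷ α ++ β)
  231-free-join v α β α<v v<β no-α no-β (b , c , a , v ∷ʳ sub , a<b , b<c) with ⊆-++-split α sub
  ... | []              , _       , refl , _    , sub₂ = no-β (b , c , a , sub₂ , a<b , b<c)
  ... | _ ∷ []          , _       , refl , sub₁ , sub₂ =
    ℕ.<-asym a<b (ℕ.<-trans (All.lookup α<v (to∈ sub₁)) (All.lookup v<β (⊆-lookup sub₂ (there (here refl)))))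
  ... | _ ∷ _ ∷ []      , _       , refl , sub₁ , sub₂ =
    ℕ.<-asym a<b (ℕ.<-trans (All.lookup α<v (⊆-lookup sub₁ (here refl))) (All.lookup v<β (to∈ sub₂)))
  ... | _ ∷ _ ∷ _ ∷ []  , []      , refl , sub₁ , _    = no-α (b , c , a , sub₁ , a<b , b<c)
  ... | _ ∷ _ ∷ _ ∷ []  , _ ∷ _   , ()   , _    , _
  ... | _ ∷ _ ∷ _ ∷ _ ∷ _ , _     , ()   , _    , _
  231-free-join v α β α<v v<β no-α no-β (.v , c , a , refl ∷ sub , a<b , b<c) with ⊆-++-split α sub
  ... | []     , _ , refl , _    , sub₂ = ℕ.<-asym a<b (All.lookup v<β (⊆-lookup sub₂ (there (here refl))))
  ... | _ ∷ _  , _ , eq   , sub₁ , _    with List.∷-injective eq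
  ...   | refl , _ = ℕ.<-asym b<c (All.lookup α<v (⊆-lookup sub₁ (here refl)))

  toPerm-left<root : ∀ L lo → All (_< lo + size L) (toPerm L lo)
  toPerm-left<root L lo = All.tabulate (proj₂ ∘ toPerm-bounds L lo)

  toPerm-root<right : ∀ R v → All (v <_) (toPerm R (suc v))
  toPerm-root<right R v = All.tabulate (proj₁ ∘ toPerm-bounds R (suc v))

  toPerm-231-free : ∀ T lo → ¬ Has231 (toPerm T lo)
  toPerm-231-free leaf       lo (_ , _ , _ , () , _)
  toPerm-231-free (node L R) lo = 231-free-join (lo + size L) (toPerm L lo) (toPerm R _)
    (toPerm-left<root L lo) (toPerm-root<right R _) (toPerm-231-free L lo) (toPerm-231-free R _)

  decreasing-split : ∀ α {β ys v} → All (_< v) α → All (v <_) β → Decreasing ys → ys ⊆ α ++ β →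
                     ys ⊆ α ⊎ ys ⊆ β
  decreasing-split []      α<v v<β dec sub = inj₂ sub
  decreasing-split (a ∷ α) (_ ∷ α<v) v<β dec (.a ∷ʳ sub) with decreasing-split α α<v v<β dec sub
  ... | inj₁ sub′ = inj₁ (a ∷ʳ sub′)
  ... | inj₂ sub′ = inj₂ sub′
  decreasing-split (a ∷ α) (a<v ∷ α<v) v<β dec (refl ∷ sub)
    with decreasing-split α α<v v<β (Decreasing-tail dec) sub
  ... | inj₁ sub′ = inj₁ (refl ∷ sub′)
  decreasing-split (a ∷ α) (a<v ∷ α<v) v<β [ .a ]       (refl ∷ sub) | inj₂ _ = inj₁ (refl ∷ minimum α)
  decreasing-split (a ∷ α) (a<v ∷ α<v) v<β (y<a ∷ dec) (refl ∷ sub) | inj₂ sub′ =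
    ⊥-elim (ℕ.<-asym (ℕ.<-trans y<a a<v) (All.lookup v<β (⊆-lookup sub′ (here refl))))

  toPerm-decreasing⇒ : ∀ T lo j → HasDecreasing j (toPerm T lo) → j ≤ leftDepth T
  toPerm-decreasing⇒ leaf lo j ([] , [] , refl , _) = z≤n
  toPerm-decreasing⇒ (node L R) lo j (ys , _ ∷ʳ sub , refl , dec)
    with decreasing-split (toPerm L lo) (toPerm-left<root L lo) (toPerm-root<right R _) dec sub
  ... | inj₁ sub′ = ℕ.≤-trans (ℕ.m≤n⇒m≤1+n (toPerm-decreasing⇒ L lo _ (ys , sub′ , refl , dec)))
                              (ℕ.m≤m⊔n (suc (leftDepth L)) (leftDepth R))
  ... | inj₂ sub′ = ℕ.≤-trans (toPerm-decreasing⇒ R _ _ (ys , sub′ , refl , dec))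
                              (ℕ.m≤n⊔m (suc (leftDepth L)) (leftDepth R))
  toPerm-decreasing⇒ (node L R) lo j (v ∷ ys , refl ∷ sub , refl , dec)
    with decreasing-split (toPerm L lo) (toPerm-left<root L lo) (toPerm-root<right R _) (Decreasing-tail dec) sub
  ... | inj₁ sub′ = ℕ.≤-trans (s≤s (toPerm-decreasing⇒ L lo _ (ys , sub′ , refl , Decreasing-tail dec)))
                              (ℕ.m≤m⊔n (suc (leftDepth L)) (leftDepth R))
  toPerm-decreasing⇒ (node L R) lo j (v ∷ [] , refl ∷ sub , refl , dec) | inj₂ _ =
    ℕ.≤-trans (s≤s z≤n) (ℕ.m≤m⊔n (suc (leftDepth L)) (leftDepth R))
  toPerm-decreasing⇒ (node L R) lo j (v ∷ y ∷ ys , refl ∷ sub , refl , y<v ∷ dec) | inj₂ sub′ =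
    ⊥-elim (ℕ.<-asym y<v (proj₁ (toPerm-bounds R _ (⊆-lookup sub′ (here refl)))))

  toPerm-decreasing⇐ : ∀ T lo j → j ≤ leftDepth T → HasDecreasing j (toPerm T lo)
  toPerm-decreasing⇐ T lo zero _ = [] , minimum _ , refl , []
  toPerm-decreasing⇐ (node L R) lo (suc j) j≤ with ≤-⊔-cases (suc (leftDepth L)) (leftDepth R) j≤
  ... | inj₂ j≤R with toPerm-decreasing⇐ R (suc (lo + size L)) (suc j) j≤R
  ...   | ys , sub , len , dec = ys , (lo + size L) ∷ʳ ++⁺ˡ (toPerm L lo) sub , len , dec
  toPerm-decreasing⇐ (node L R) lo (suc j) j≤ | inj₁ j≤L with toPerm-decreasing⇐ L lo j (ℕ.≤-pred j≤L)
  ... | ys , sub , len , dec = (lo + size L) ∷ ys , refl ∷ ++⁺ʳ _ sub , cong suc len , extend ys sub dec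
    where
    -- the root value exceeds every value of the left subtree
    extend : ∀ ys → ys ⊆ toPerm L lo → Decreasing ys → Decreasing ((lo + size L) ∷ ys)
    extend []      _   _   = [ _ ]
    extend (y ∷ _) sub dec = proj₂ (toPerm-bounds L lo (⊆-lookup sub (here refl))) ∷ dec

  interval-cut : ∀ lo m {v} → v ∈ interval lo (suc m) →
    Σ[ a ∈ ℕ ] Σ[ b ∈ ℕ ] a + b ≡ m × lo + a ≡ v ×
      interval lo (suc m) ≡ interval lo a ++ v ∷ interval (suc v) b
  interval-cut lo m {v} v∈ = a , m ∸ a , a+b≡m , lo+a≡v , cut
    where
    bounds = ∈-interval lo (suc m) v∈
    a = v ∸ lo
    lo+a≡v : lo + a ≡ v
    lo+a≡v = ℕ.m+[n∸m]≡n (proj₁ bounds)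
    a≤m : a ≤ m
    a≤m = ℕ.≤-pred (subst (a <_) (ℕ.m+n∸m≡n lo (suc m)) (ℕ.∸-monoˡ-< (proj₂ bounds) (proj₁ bounds)))
    a+b≡m : a + (m ∸ a) ≡ m
    a+b≡m = ℕ.m+[n∸m]≡n a≤m
    cut : interval lo (suc m) ≡ interval lo a ++ v ∷ interval (suc v) (m ∸ a)
    cut = begin
      interval lo (suc m)                                  ≡⟨ cong (interval lo ∘ suc) a+b≡m ⟨
      interval lo (suc (a + (m ∸ a)))                      ≡⟨ cong (interval lo) (ℕ.+-suc a (m ∸ a)) ⟨
      interval lo (a + suc (m ∸ a))                        ≡⟨ interval-split lo a (m ∸ a) ⟩
      interval lo a ++ (lo + a) ∷ interval (suc (lo + a)) (m ∸ a)
                                                           ≡⟨ cong (λ w → interval lo a ++ w ∷ interval (suc w) (m ∸ a)) lo+a≡v ⟩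
      interval lo a ++ v ∷ interval (suc v) (m ∸ a)        ∎
      where open ≡-Reasoning

  below-then-above : ∀ v τ → All (λ x → x < v ⊎ v < x) τ →
    (∀ {x y} → (x ∷ y ∷ []) ⊆ τ → v < x → y < v → ⊥) →
    τ ≡ filter (_<? v) τ ++ filter (v <?_) τ
  below-then-above v []      _                 _        = refl
  below-then-above v (x ∷ τ) (inj₁ x<v ∷ τ-cmp) no-inversion = begin
    x ∷ τ                                          ≡⟨ cong (x ∷_) (below-then-above v τ τ-cmp (no-inversion ∘ (x ∷ʳ_))) ⟩
    x ∷ (filter (_<? v) τ ++ filter (v <?_) τ)     ≡⟨ cong₂ _++_ (List.filter-accept (_<? v) x<v)
                                                              (List.filter-reject (v <?_) (ℕ.<-asym x<v)) ⟨
    filter (_<? v) (x ∷ τ) ++ filter (v <?_) (x ∷ τ) ∎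
    where open ≡-Reasoning
  below-then-above v (x ∷ τ) (inj₂ v<x ∷ τ-cmp) no-inversion = begin
    x ∷ τ                                          ≡⟨ cong (x ∷_) (List.filter-all (v <?_) τ>v) ⟨
    x ∷ filter (v <?_) τ                           ≡⟨ cong₂ _++_ (List.filter-none (_<? v) (All.map ℕ.<⇒≯ τ>v))
                                                              (List.filter-accept (v <?_) v<x) ⟨
    filter (_<? v) τ ++ filter (v <?_) (x ∷ τ)     ≡⟨ cong (_++ filter (v <?_) (x ∷ τ)) (List.filter-reject (_<? v) (ℕ.<⇒≯ v<x)) ⟨
    filter (_<? v) (x ∷ τ) ++ filter (v <?_) (x ∷ τ) ∎
    where
    open ≡-Reasoning
    -- every later value y is above v: y < v would make x y an inversion around v
    τ>v : All (v <_) τ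
    τ>v = All.tabulate λ {y} y∈ → [ (λ y<v → ⊥-elim (no-inversion (refl ∷ from∈ y∈) v<x y<v)) , (λ v<y → v<y) ]′
                                     (All.lookup τ-cmp y∈)

  record RootSplit (lo m v : ℕ) (τ : List ℕ) : Set where
    field
      a b     : ℕ
      a+b≡m   : a + b ≡ m
      lo+a≡v  : lo + a ≡ v
      α β     : List ℕ
      τ≡α++β  : τ ≡ α ++ β
      α↭      : α ↭ interval lo a
      β↭      : β ↭ interval (suc v) b
      α-free  : ¬ Has231 α
      β-free  : ¬ Has231 β

  root-split : ∀ lo m v τ → v ∷ τ ↭ interval lo (suc m) → ¬ Has231 (v ∷ τ) → RootSplit lo m v τ
  root-split lo m v τ π↭ π-free = record
    { a = a ; b = b ; a+b≡m = a+b≡m ; lo+a≡v = lo+a≡v ; α = α ; β = β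
    ; τ≡α++β = below-then-above v τ (All.tabulate compare) (λ sub v<x y<v → π-free (v , _ , _ , refl ∷ sub , y<v , v<x))
    ; α↭ = subst (α ↭_) filter-below (Perm.filter-↭ (_<? v) τ↭)
    ; β↭ = subst (β ↭_) filter-above (Perm.filter-↭ (v <?_) τ↭)
    ; α-free = λ (b , c , a , sub , a<b , b<c) → π-free (b , c , a , v ∷ʳ ⊆-trans sub (filter-⊆ (_<? v) τ) , a<b , b<c)
    ; β-free = λ (b , c , a , sub , a<b , b<c) → π-free (b , c , a , v ∷ʳ ⊆-trans sub (filter-⊆ (v <?_) τ) , a<b , b<c)
    }
    where
    cut = interval-cut lo m (Perm.∈-resp-↭ π↭ (here refl))
    a = proj₁ cut
    b = proj₁ (proj₂ cut)
    a+b≡m = proj₁ (proj₂ (proj₂ cut))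
    lo+a≡v = proj₁ (proj₂ (proj₂ (proj₂ cut)))
    A = interval lo a
    B = interval (suc v) b
    α = filter (_<? v) τ
    β = filter (v <?_) τ
    -- removing v from both sides of v ∷ τ ↭ A ++ v ∷ B
    τ↭ : τ ↭ A ++ B
    τ↭ = Perm.drop-mid [] A (subst (v ∷ τ ↭_) (proj₂ (proj₂ (proj₂ (proj₂ cut)))) π↭)
    below-v : ∀ {y} → y ∈ A → y < v
    below-v y∈ = subst (_ <_) lo+a≡v (proj₂ (∈-interval lo a y∈))
    above-v : ∀ {y} → y ∈ B → v < y
    above-v y∈ = proj₁ (∈-interval (suc v) b y∈)
    compare : ∀ {x} → x ∈ τ → x < v ⊎ v < x
    compare x∈ with ∈-++⁻ A (Perm.∈-resp-↭ τ↭ x∈)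
    ... | inj₁ x∈A = inj₁ (below-v x∈A)
    ... | inj₂ x∈B = inj₂ (above-v x∈B)
    filter-below : filter (_<? v) (A ++ B) ≡ A
    filter-below = begin
      filter (_<? v) (A ++ B)               ≡⟨ List.filter-++ (_<? v) A B ⟩
      filter (_<? v) A ++ filter (_<? v) B  ≡⟨ cong₂ _++_ (List.filter-all (_<? v) (All.tabulate below-v))
                                                         (List.filter-none (_<? v) (All.tabulate (ℕ.<⇒≯ ∘ above-v))) ⟩
      A ++ []                               ≡⟨ List.++-identityʳ A ⟩
      A                                     ∎
      where open ≡-Reasoning
    filter-above : filter (v <?_) (A ++ B) ≡ B
    filter-above = trans (List.filter-++ (v <?_) A B)
      (cong₂ _++_ (List.filter-none (v <?_) (All.tabulate (ℕ.<⇒≯ ∘ below-v))) (List.filter-all (v <?_) (All.tabulate above-v)))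

  toPerm-surjective : ∀ m lo π → π ↭ interval lo m → ¬ Has231 π → Σ[ T ∈ Tree ] size T ≡ m × toPerm T lo ≡ π
  toPerm-surjective = <-rec _ build
    where
    Goal : ℕ → Set
    Goal m = ∀ lo π → π ↭ interval lo m → ¬ Has231 π → Σ[ T ∈ Tree ] size T ≡ m × toPerm T lo ≡ π
    build : ∀ m → (∀ {k} → k < m → Goal k) → Goal m
    build zero    _   lo π       π↭ _ rewrite Perm.↭-empty-inv π↭ = leaf , refl , refl
    build (suc m) _   lo []      π↭ _ with () ← Perm.↭-length π↭
    build (suc m) rec lo (v ∷ τ) π↭ π-free = node L R , size≡ , toPerm≡
      where
      open RootSplit (root-split lo m v τ π↭ π-free)
      leftTree  = rec (s≤s (subst (a ≤_) a+b≡m (ℕ.m≤m+n a b))) lo α α↭ α-free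
      rightTree = rec (s≤s (subst (b ≤_) a+b≡m (ℕ.m≤n+m b a))) (suc v) β β↭ β-free
      L = proj₁ leftTree
      R = proj₁ rightTree
      size≡ : suc (size L + size R) ≡ suc m
      size≡ = cong suc (trans (cong₂ _+_ (proj₁ (proj₂ leftTree)) (proj₁ (proj₂ rightTree))) a+b≡m)
      toPerm≡ : toPerm (node L R) lo ≡ v ∷ τ
      toPerm≡ = begin
        (lo + size L) ∷ (toPerm L lo ++ toPerm R (suc (lo + size L)))
          ≡⟨ cong (λ s → (lo + s) ∷ (toPerm L lo ++ toPerm R (suc (lo + s)))) (proj₁ (proj₂ leftTree)) ⟩
        (lo + a) ∷ (toPerm L lo ++ toPerm R (suc (lo + a)))
          ≡⟨ cong (λ w → w ∷ (toPerm L lo ++ toPerm R (suc w))) lo+a≡v ⟩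
        v ∷ (toPerm L lo ++ toPerm R (suc v))
          ≡⟨ cong (v ∷_) (cong₂ _++_ (proj₂ (proj₂ leftTree)) (proj₂ (proj₂ rightTree))) ⟩
        v ∷ (α ++ β)
          ≡⟨ cong (v ∷_) τ≡α++β ⟨
        v ∷ τ ∎
        where open ≡-Reasoning

  -- Containment of the patterns 231 and j ⋯ 2 1 in the sense of Defs
  -- (order-isomorphic subsequence) is Has231 and HasDecreasing; order
  -- isomorphism is checked entrywise, with two true or two false comparisons.
  both-true : ∀ {P Q : Set} → P → Q → P ⇔ Q
  both-true p q = mk⇔ (λ _ → q) (λ _ → p)

  both-false : ∀ {P Q : Set} → ¬ P → ¬ Q → P ⇔ Q
  both-false ¬p ¬q = mk⇔ (⊥-elim ∘ ¬p) (⊥-elim ∘ ¬q)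

  contains-231⇒ : ∀ π → PContains π p231 → Has231 π
  contains-231⇒ π (b ∷ c ∷ a ∷ [] , sub , _ , same) =
    b , c , a , sub , from (same (fsuc (fsuc fzero)) fzero) (s≤s (s≤s z≤n))
                    , from (same fzero (fsuc fzero)) (s≤s (s≤s (s≤s z≤n)))

  contains-231⇐ : ∀ π → Has231 π → PContains π p231
  contains-231⇐ π (b , c , a , sub , a<b , b<c) = b ∷ c ∷ a ∷ [] , sub , refl , same
    where
    a<c = ℕ.<-trans a<b b<c
    1<2 : 1 < 2
    1<2 = s≤s (s≤s z≤n)
    1<3 : 1 < 3
    1<3 = s≤s (s≤s z≤n)
    2<3 : 2 < 3
    2<3 = s≤s (s≤s (s≤s z≤n))
    same : ∀ i j → (lookup (b ∷ c ∷ a ∷ []) i < lookup (b ∷ c ∷ a ∷ []) j)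
                 ⇔ (lookup p231 (cast refl i) < lookup p231 (cast refl j))
    same fzero               fzero               = both-false (ℕ.n≮n _) (ℕ.n≮n _)
    same fzero               (fsuc fzero)        = both-true b<c 2<3
    same fzero               (fsuc (fsuc fzero)) = both-false (ℕ.<-asym a<b) (ℕ.<-asym 1<2)
    same (fsuc fzero)        fzero               = both-false (ℕ.<-asym b<c) (ℕ.<-asym 2<3)
    same (fsuc fzero)        (fsuc fzero)        = both-false (ℕ.n≮n _) (ℕ.n≮n _)
    same (fsuc fzero)        (fsuc (fsuc fzero)) = both-false (ℕ.<-asym a<c) (ℕ.<-asym 1<3)
    same (fsuc (fsuc fzero)) fzero               = both-true a<b 1<2
    same (fsuc (fsuc fzero)) (fsuc fzero)        = both-true a<c 1<3
    same (fsuc (fsuc fzero)) (fsuc (fsuc fzero)) = both-false (ℕ.n≮n _) (ℕ.n≮n _)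

  length-decreasing : ∀ j → length (decreasing j) ≡ j
  length-decreasing zero    = refl
  length-decreasing (suc j) = cong suc (length-decreasing j)

  decreasing-bound : ∀ j k → lookup (decreasing j) k ≤ j
  decreasing-bound (suc j) fzero    = ℕ.≤-refl
  decreasing-bound (suc j) (fsuc k) = ℕ.m≤n⇒m≤1+n (decreasing-bound j k)

  head-largest : ∀ {y ys} → Decreasing (y ∷ ys) → ∀ k → lookup ys k < y
  head-largest (y′<y ∷ dec) fzero    = y′<y
  head-largest (y′<y ∷ dec) (fsuc k) = ℕ.<-trans (head-largest dec k) y′<y

  sameOrder⇒decreasing : ∀ ys j (len : length ys ≡ length (decreasing j)) →
    (∀ a b → (lookup ys a < lookup ys b)
             ⇔ (lookup (decreasing j) (cast len a) < lookup (decreasing j) (cast len b))) →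
    Decreasing ys
  sameOrder⇒decreasing []           j                 len same = []
  sameOrder⇒decreasing (y ∷ [])     j                 len same = [ y ]
  sameOrder⇒decreasing (y ∷ _ ∷ _)  zero              ()  same
  sameOrder⇒decreasing (y ∷ _ ∷ _)  (suc zero)        ()  same
  sameOrder⇒decreasing (y ∷ y′ ∷ ys) (suc (suc j))    len same =
    from (same (fsuc fzero) fzero) (ℕ.n<1+n (suc j))
    ∷ sameOrder⇒decreasing (y′ ∷ ys) (suc j) (ℕ.suc-injective len) (λ a b → same (fsuc a) (fsuc b))

  decreasing⇒sameOrder : ∀ ys → Decreasing ys → SameOrder ys (decreasing (length ys))
  decreasing⇒sameOrder []       dec = refl , λ ()
  decreasing⇒sameOrder (y ∷ ys) dec with decreasing⇒sameOrder ys (Decreasing-tail dec)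
  ... | len , same = cong suc len , same′
    where
    same′ : ∀ a b → (lookup (y ∷ ys) a < lookup (y ∷ ys) b)
                    ⇔ (lookup (decreasing (suc (length ys))) (cast (cong suc len) a)
                       < lookup (decreasing (suc (length ys))) (cast (cong suc len) b))
    same′ fzero    fzero    = both-false (ℕ.n≮n _) (ℕ.n≮n _)
    same′ fzero    (fsuc b) = both-false (ℕ.<-asym (head-largest dec b))
      (λ lt → ℕ.n≮n _ (ℕ.<-≤-trans lt (ℕ.m≤n⇒m≤1+n (decreasing-bound (length ys) _))))
    same′ (fsuc a) fzero    = both-true (head-largest dec a) (s≤s (decreasing-bound (length ys) _))
    same′ (fsuc a) (fsuc b) = same a b

  contains-decreasing⇒ : ∀ π j → PContains π (decreasing j) → HasDecreasing j π
  contains-decreasing⇒ π j (ys , sub , len , same) =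
    ys , sub , trans len (length-decreasing j) , sameOrder⇒decreasing ys j len same

  contains-decreasing⇐ : ∀ π j → HasDecreasing j π → PContains π (decreasing j)
  contains-decreasing⇐ π j (ys , sub , refl , dec) = ys , sub , decreasing⇒sameOrder ys dec

module Cardinalities where

  open Containment using (avoids?)
  open Enumeration
  open Counting using (count; length-filter)
  open WilfEquivalence using (comb)
  open Permutations
  open import Data.Nat using (suc)
  import Data.Nat.Properties as ℕ
  open import Data.List using (map; filter; upTo)
  open import Data.List.Membership.Propositional using (_∈_)
  open import Data.List.Membership.Propositional.Properties using (∈-filter⁻; ∈-filter⁺; ∈-map⁻; ∈-map⁺)
  open import Data.List.Relation.Unary.Any using (here; there)
  open import Data.List.Relation.Binary.Permutation.Propositional using (_↭_)
  import Data.List.Relation.Unary.Unique.Propositional.Properties as Unique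
  import Data.List.Properties as List
  open import Data.Product using (Σ-syntax; _,_)
  open import Function.Bundles using (mk⇔)
  open import Relation.Binary.PropositionalEquality

  trees-leaves : ∀ n {T} → T ∈ trees n → leaves T ≡ n
  trees-leaves n = treesWithin-leaves n n

  trees-complete : ∀ T → T ∈ trees (leaves T)
  trees-complete T = treesWithin-complete (leaves T) T ℕ.≤-refl

  avoiders : Tree → ℕ → List Tree
  avoiders t n = filter (λ T → avoids? T t) (trees n)

  avoiders-card : ∀ t n → AvTree t n (count t n)
  avoiders-card t n = avoiders t n , Unique.filter⁺ (λ T → avoids? T t) (treesWithin-unique n n) ,
    (λ T → mk⇔ (λ T∈ → let (T∈trees , T-avoids) = ∈-filter⁻ (λ T → avoids? T t) T∈
                        in trees-leaves n T∈trees , T-avoids)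
               (λ (leaves≡n , T-avoids) → ∈-filter⁺ (λ T → avoids? T t)
                  (subst (λ k → T ∈ trees k) leaves≡n (trees-complete T)) T-avoids)) ,
    length-filter (λ T → avoids? T t) (trees n)

  toPerm-avoids : ∀ j m T → leaves T ≡ suc m → Avoids T (comb j) →
                  IsPerm m (toPerm T 1) × AvoidsAll (toPerm T 1) (p231 ∷ decreasing j ∷ [])
  toPerm-avoids j m T leaves≡ T-avoids = is-perm , avoids
    where
    size≡m : size T ≡ m
    size≡m = ℕ.suc-injective (trans (sym (leaves≡suc-size T)) leaves≡)
    is-perm : toPerm T 1 ↭ map suc (upTo m)
    is-perm = subst (toPerm T 1 ↭_) (sym (interval-from-1 m))
                (subst (λ k → toPerm T 1 ↭ interval 1 k) size≡m (toPerm-↭ T 1))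
    avoids : AvoidsAll (toPerm T 1) (p231 ∷ decreasing j ∷ [])
    avoids .p231           (here refl)         c = toPerm-231-free T 1 (contains-231⇒ _ c)
    avoids .(decreasing j) (there (here refl)) c =
      T-avoids (contains-comb⇐ T j (toPerm-decreasing⇒ T 1 j (contains-decreasing⇒ _ j c)))

  toPerm-onto : ∀ j m π → IsPerm m π → AvoidsAll π (p231 ∷ decreasing j ∷ []) →
                Σ[ T ∈ Tree ] leaves T ≡ suc m × Avoids T (comb j) × toPerm T 1 ≡ π
  toPerm-onto j m π π-perm π-avoids
    with toPerm-surjective m 1 π (subst (π ↭_) (interval-from-1 m) π-perm)
                           (λ has → π-avoids p231 (here refl) (contains-231⇐ π has))
  ... | T , size≡m , toPerm≡π = T , trans (leaves≡suc-size T) (cong suc size≡m) , T-avoids , toPerm≡π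
    where
    T-avoids : Avoids T (comb j)
    T-avoids c = π-avoids (decreasing j) (there (here refl))
      (subst (λ σ → PContains σ (decreasing j)) toPerm≡π
        (contains-decreasing⇐ _ j (toPerm-decreasing⇐ T 1 j (contains-comb⇒ T j c))))

  perms-card : ∀ j m → SQ (p231 ∷ decreasing j ∷ []) m (count (comb j) (suc m))
  perms-card j m = map (λ T → toPerm T 1) (avoiders (comb j) (suc m)) ,
    Unique.map⁺ (λ {T} {T′} → toPerm-injective T T′ 1)
      (Unique.filter⁺ (λ T → avoids? T (comb j)) (treesWithin-unique (suc m) (suc m))) ,
    (λ π → mk⇔ (from-avoider π) (to-avoider π)) ,
    trans (List.length-map _ (avoiders (comb j) (suc m))) (length-filter (λ T → avoids? T (comb j)) (trees (suc m)))
    where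
    from-avoider : ∀ π → π ∈ map (λ T → toPerm T 1) (avoiders (comb j) (suc m)) →
                   IsPerm m π × AvoidsAll π (p231 ∷ decreasing j ∷ [])
    from-avoider π π∈ with ∈-map⁻ (λ T → toPerm T 1) π∈
    ... | T , T∈ , refl with ∈-filter⁻ (λ T → avoids? T (comb j)) T∈
    ...   | T∈trees , T-avoids = toPerm-avoids j m T (trees-leaves (suc m) T∈trees) T-avoids
    to-avoider : ∀ π → IsPerm m π × AvoidsAll π (p231 ∷ decreasing j ∷ []) →
                 π ∈ map (λ T → toPerm T 1) (avoiders (comb j) (suc m))
    to-avoider π (π-perm , π-avoids) with toPerm-onto j m π π-perm π-avoids
    ... | T , leaves≡ , T-avoids , refl = ∈-map⁺ (λ T → toPerm T 1)
          (∈-filter⁺ (λ T → avoids? T (comb j)) (subst (λ k → T ∈ trees k) leaves≡ (trees-complete T)) T-avoids)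

open Cardinalities
open Counting using (count)
open WilfEquivalence using (count-comb)
open Enumeration using (size; leaves≡suc-size)

theorem6 : (t : Tree) → 2 ≤ leaves t → (n : ℕ) → 1 ≤ n →
    ∃ λ m → AvTree t n m × SQ (p231 ∷ decreasing (leaves t ∸ 1) ∷ []) (n ∸ 1) m
theorem6 t _ (suc m) _ = count t (suc m) , avoiders-card t (suc m) , permutations
  where
  permutations : SQ (p231 ∷ decreasing (leaves t ∸ 1) ∷ []) m (count t (suc m))
  permutations rewrite leaves≡suc-size t | count-comb t (suc m) = perms-card (size t) m
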